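{- Let $G=(B,G_1,\dots,G_k)$ be a BAB-graph. Then each of the subgraphs $G[V(C_1)],\dots,G[V(C_k)]$ (where $C_i$ is the unique odd cycle of $G_i$) is a connected component of $G[D(G)]$, and every other connected component of $G[D(G)]$ is an isolated vertex.
   Context: All graphs are finite and simple. For a graph $H$, the Gallai–Edmonds sets are: $D(H)$ is the set of vertices $v$ such that some maximum matching of $H$ does not cover $v$; $A(H)$ is the set of vertices not in $D(H)$ that are adjacent to some vertex of $D(H)$; and $C(H)=V(H)\setminus(D(H)\cup A(H))$. A graph is almost bipartite if it contains exactly one odd cycle. It is König–Egerváry if $\alpha(H)+\mu(H)=|V(H)|$. Let $M$ be a matching of $H$. An $M$-blossom is an odd cycle of length $2t+1$ containing exactly $t$ edges of $M$; its base is the vertex of the cycle not covered by the $M$-edges of the cycle. An $M$-stem is an $M$-alternating path of even length (possibly $0$) from the base to a vertex not covered by $M$, sharing only the base with the blossom. An $M$-flower is the union of a blossom and a stem. BAB-graph: let $B$ be a bipartite graph (possibly empty) and $G_1,\dots,G_k$ graphs, all pairwise vertex-disjoint, where each $G_i$ is an almost bipartite non-König–Egerváry graph with unique odd cycle $C_i$, such that every vertex of $G_i$ lies in some $M$-flower of $G_i$ with blossom $C_i$ for some maximum matching $M$ of $G_i$. The graph $G$ is obtained from $B\cup G_1\cup\dots\cup G_k$ by adding edges, each joining vertices of two different graphs among $B,G_1,\dots,G_k$, such that every vertex of $B$ incident with an added edge lies in $A(B)\cup C(B)$, and every vertex of $G_i$ incident with an added edge lies in $A(G_i)$. It is denoted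 $(B,G_1,\dots,G_k)$. -}

module Defs where

open import Data.Nat using (ℕ; zero; suc; _+_; _≤_)
open import Data.Nat.DivMod using (_mod_)
open import Data.Bool using (Bool; true; false)
open import Data.Fin using (Fin; toℕ; inject₁; fromℕ) renaming (_≟_ to _≟ᶠ_)
open import Data.Fin as F using ()
open import Data.Maybe using (Maybe; nothing; just)
open import Data.Maybe.Properties using (≡-dec)
open import Data.List using (List; []; _∷_; length; concatMap; filterᵇ; allFin)
open import Data.List.Membership.Propositional using (_∈_)
open import Data.List.Relation.Unary.All using (All)
open import Data.List.Relation.Unary.Unique.Propositional using (Unique)
open import Data.Product using (Σ; ∃; _×_; _,_; proj₁; proj₂)
open import Data.Sum using (_⊎_)
open import Relation.Nullary using (¬_)
open import Relation.Nullary.Decidable using (⌊_⌋)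
open import Relation.Binary.PropositionalEquality using (_≡_; _≢_)
open import Function.Bundles using (_⇔_)

record Graph (n : ℕ) : Set where
  field
    adj    : Fin n → Fin n → Bool
    sym    : ∀ u v → adj u v ≡ adj v u
    irrefl : ∀ v → adj v v ≡ false
open Graph public

Edge : ∀ {n} → Graph n → Fin n → Fin n → Set
Edge G u v = adj G u v ≡ true

-- A vertex subset; a graph "H" below is always an induced subgraph G[S].
VSet : ℕ → Set
VSet n = Fin n → Bool

_∈ˢ_ : ∀ {n} → Fin n → VSet n → Set
v ∈ˢ S = S v ≡ true

full : ∀ {n} → VSet n
full _ = true

size : ∀ {n} → VSet n → ℕ
size {n} S = length (filterᵇ S (allFin n))

endpoints : ∀ {n} → List (Fin n × Fin n) → List (Fin n)
endpoints = concatMap (λ e → proj₁ e ∷ proj₂ e ∷ [])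

IsMatching : ∀ {n} → Graph n → VSet n → List (Fin n × Fin n) → Set
IsMatching G S M =
  Unique (endpoints M) ×
  All (λ e → Edge G (proj₁ e) (proj₂ e) × proj₁ e ∈ˢ S × proj₂ e ∈ˢ S) M

IsMaxMatching : ∀ {n} → Graph n → VSet n → List (Fin n × Fin n) → Set
IsMaxMatching G S M =
  IsMatching G S M × (∀ M′ → IsMatching G S M′ → length M′ ≤ length M)

Covered : ∀ {n} → List (Fin n × Fin n) → Fin n → Set
Covered M v = v ∈ endpoints M

InM : ∀ {n} → List (Fin n × Fin n) → Fin n → Fin n → Set
InM M u v = (u , v) ∈ M ⊎ (v , u) ∈ M

IsIndep : ∀ {n} → Graph n → VSet n → List (Fin n) → Set
IsIndep G S I =
  Unique I × All (_∈ˢ S) I × (∀ u v → u ∈ I → v ∈ I → adj G u v ≡ false)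

IsMaxIndep : ∀ {n} → Graph n → VSet n → List (Fin n) → Set
IsMaxIndep G S I = IsIndep G S I × (∀ I′ → IsIndep G S I′ → length I′ ≤ length I)

KE : ∀ {n} → Graph n → VSet n → Set
KE G S = Σ _ λ I → Σ _ λ M →
  IsMaxIndep G S I × IsMaxMatching G S M × length I + length M ≡ size S

D : ∀ {n} → Graph n → VSet n → Fin n → Set
D G S v = v ∈ˢ S × Σ _ λ M → IsMaxMatching G S M × ¬ Covered M v

A : ∀ {n} → Graph n → VSet n → Fin n → Set
A G S v = v ∈ˢ S × ¬ D G S v × Σ _ λ u → D G S u × Edge G u v

C : ∀ {n} → Graph n → VSet n → Fin n → Set
C G S v = v ∈ˢ S × ¬ D G S v × ¬ A G S v

Bipartite : ∀ {n} → Graph n → VSet n → Set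
Bipartite {n} G S = Σ (Fin n → Bool) λ col →
  ∀ u v → u ∈ˢ S → v ∈ˢ S → Edge G u v → col u ≢ col v

next : ∀ {L} → Fin L → Fin L
next {suc m} i = suc (toℕ i) mod suc m

record Cycle {n} (G : Graph n) (S : VSet n) : Set where
  field
    len  : ℕ
    len≥3 : 3 ≤ len
    vert : Fin len → Fin n
    inj  : ∀ i j → vert i ≡ vert j → i ≡ j
    inS  : ∀ i → vert i ∈ˢ S
    adjc : ∀ i → Edge G (vert i) (vert (next i))
open Cycle public

OddCycle : ∀ {n} {G : Graph n} {S} → Cycle G S → Set
OddCycle c = Σ ℕ λ t → len c ≡ suc (t + t)

OnCycle : ∀ {n} {G : Graph n} {S} → Cycle G S → Fin n → Set
OnCycle c v = Σ _ λ j → vert c j ≡ v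

CycleEdge : ∀ {n} {G : Graph n} {S} → Cycle G S → Fin n → Fin n → Set
CycleEdge c u v = Σ _ λ i →
  (vert c i ≡ u × vert c (next i) ≡ v) ⊎ (vert c i ≡ v × vert c (next i) ≡ u)

-- cycles as subgraphs: equal iff same edge set
SameCycle : ∀ {n} {G : Graph n} {S} → Cycle G S → Cycle G S → Set
SameCycle c c′ = ∀ u v → CycleEdge c u v ⇔ CycleEdge c′ u v

IsUniqueOddCycle : ∀ {n} (G : Graph n) (S : VSet n) → Cycle G S → Set
IsUniqueOddCycle G S c = OddCycle c × (∀ c′ → OddCycle c′ → SameCycle c c′)

AlmostBipartite : ∀ {n} → Graph n → VSet n → Set
AlmostBipartite G S = Σ (Cycle G S) (IsUniqueOddCycle G S)

record Path {n} (G : Graph n) (S : VSet n) : Set where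
  field
    plen  : ℕ   -- number of edges
    pvert : Fin (suc plen) → Fin n
    pinj  : ∀ i j → pvert i ≡ pvert j → i ≡ j
    pinS  : ∀ i → pvert i ∈ˢ S
    padj  : ∀ (i : Fin plen) → Edge G (pvert (inject₁ i)) (pvert (F.suc i))
open Path public

PathEdgeInM : ∀ {n} {G : Graph n} {S} → List (Fin n × Fin n) → (P : Path G S) → Fin (plen P) → Set
PathEdgeInM M P i = InM M (pvert P (inject₁ i)) (pvert P (F.suc i))

Alternating : ∀ {n} {G : Graph n} {S} → List (Fin n × Fin n) → Path G S → Set
Alternating M P = ∀ i j → toℕ j ≡ suc (toℕ i) →
  (PathEdgeInM M P j ⇔ (¬ PathEdgeInM M P i))

IsBlossom : ∀ {n} {G : Graph n} {S} → List (Fin n × Fin n) → Cycle G S → Set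
IsBlossom M c = Σ ℕ λ t → len c ≡ suc (t + t) ×
  Σ (List (Fin (len c))) λ idx → Unique idx × length idx ≡ t ×
    (∀ i → (i ∈ idx) ⇔ InM M (vert c i) (vert c (next i)))

IsBase : ∀ {n} {G : Graph n} {S} → List (Fin n × Fin n) → Cycle G S → Fin n → Set
IsBase M c b = OnCycle c b ×
  (∀ i → InM M (vert c i) (vert c (next i)) → vert c i ≢ b × vert c (next i) ≢ b)

IsStem : ∀ {n} {G : Graph n} {S} → List (Fin n × Fin n) → Cycle G S → Fin n → Path G S → Set
IsStem M c b P =
  pvert P F.zero ≡ b ×
  (Σ ℕ λ s → plen P ≡ s + s) ×
  Alternating M P ×
  ¬ Covered M (pvert P (fromℕ (plen P))) ×
  (∀ k → OnCycle c (pvert P k) → pvert P k ≡ b)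

InSomeFlower : ∀ {n} (G : Graph n) (S : VSet n) → Cycle G S → Fin n → Set
InSomeFlower G S c v = Σ _ λ M → IsMaxMatching G S M × IsBlossom M c ×
  Σ _ λ b → IsBase M c b × Σ (Path G S) λ P → IsStem M c b P ×
    (OnCycle c v ⊎ Σ _ λ k → pvert P k ≡ v)

-- The pieces B, G_1..G_k are the induced subgraphs of G on
-- the classes of a partition `part` (nothing ↦ B, just i ↦ G_i); the
-- added edges are exactly the edges of G between different classes.

piece : ∀ {n k} → (Fin n → Maybe (Fin k)) → Maybe (Fin k) → VSet n
piece part p v = ⌊ ≡-dec _≟ᶠ_ (part v) p ⌋

CrossOK : ∀ {n k} → Graph n → (Fin n → Maybe (Fin k)) → Maybe (Fin k) → Fin n → Set
CrossOK G part nothing  u = A G (piece part nothing) u ⊎ C G (piece part nothing) u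
CrossOK G part (just i) u = A G (piece part (just i)) u

record BAB {n} (G : Graph n) (k : ℕ) : Set where
  field
    part      : Fin n → Maybe (Fin k)
    B-bip     : Bipartite G (piece part nothing)
    cyc       : (i : Fin k) → Cycle G (piece part (just i))
    cyc-uniq  : ∀ i → IsUniqueOddCycle G (piece part (just i)) (cyc i)
    nonKE     : ∀ i → ¬ KE G (piece part (just i))
    flowers   : ∀ i v → v ∈ˢ piece part (just i) →
                InSomeFlower G (piece part (just i)) (cyc i) v
    cross     : ∀ u v → Edge G u v → part u ≢ part v → CrossOK G part (part u) u
open BAB public

-- Connected components of G[T]  (T, X : vertex predicates)

data Reach {n} (G : Graph n) (X : Fin n → Set) : Fin n → Fin n → Set where
  here : ∀ {u} → Reach G X u u
  step : ∀ {u w v} → Edge G u w → X w → Reach G X w v → Reach G X u v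

IsComponent : ∀ {n} → Graph n → (T X : Fin n → Set) → Set
IsComponent G T X =
  (∀ v → X v → T v) ×
  (Σ _ X) ×
  (∀ u v → X u → X v → Reach G X u v) ×
  (∀ u v → X u → T v → Edge G u v → X v)

{-# OPTIONS --safe #-}
-- Every matching of G splits into matchings inside the pieces plus edges between pieces, and those
-- edges only touch vertices outside D of their piece. A deficiency count along alternating paths then
-- shows that the union of maximum matchings of the pieces is maximum in G, so D(G) is the union of the
-- sets D of the pieces. Hence two adjacent vertices of D(G) lie in D(H) for one piece H, where they are
-- joined by an even alternating path; with the edge this closes an odd cycle, which is impossible in the
-- bipartite B and must be C_i inside G_i. Conversely, in a flower, shifting the missed vertex along the
-- stem frees the base, and walking round the blossom in the right direction frees any of its vertices,
-- so C_i ⊆ D(G).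
module Submission where

open import Defs hiding (sym)
open import Data.Nat using (ℕ; zero; suc; _+_; _∸_; _≤_; _<_; _≤?_; z≤n; s≤s; NonZero)
open import Data.Nat.Properties
  using ( +-suc; +-comm; +-assoc; +-identityʳ; ≤-refl; ≤-reflexive; ≤-trans; <-trans; ≤-<-trans; ≤-pred
        ; <⇒≤; <⇒≢; <⇒≱; ≰⇒>
        ; <-irrefl; ≤∧≢⇒<; n≤1+n; n<1+n; m<n⇒m<1+n; m≤m+n; m≤n+m; m<m+n; m+n≤o⇒m≤o; m+[n∸m]≡n
        ; +-mono-≤; +-mono-<; +-mono-<-≤; +-mono-≤-<; +-monoˡ-≤; +-monoʳ-≤; +-monoʳ-<; module ≤-Reasoning)
import Data.Nat.Properties as ℕ
open import Algebra.Properties.CommutativeSemigroup ℕ.+-commutativeSemigroup using () renaming (interchange to +-interchange)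
open import Data.Nat.DivMod using (_%_; _mod_; %-distribˡ-+; m%n%n≡m%n; [m+n]%n≡m%n; m<n⇒m%n≡m; n%n≡0; m%n<n)
open import Data.Nat.GeneralisedArithmetic using (iterate)
open import Data.Nat.ListAction using (sum)
open import Data.Nat.Solver using (module +-*-Solver)
open +-*-Solver using (solve; _:+_; _:=_; con)
open import Data.Fin using (Fin; toℕ; fromℕ; fromℕ<; inject₁) renaming (zero to fzero; suc to fsuc; _≟_ to _≟ᶠ_)
import Data.Fin.Properties as Fin
open import Data.Bool using (Bool; true; false; _∧_; not)
open import Data.Bool.Properties using (∧-identityʳ; ∧-zeroʳ; not-involutive; ¬-not) renaming (_≟_ to _≟ᵇ_)
open import Data.Maybe using (Maybe; nothing; just)
import Data.Maybe.Properties as Maybe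
open import Data.List using (List; []; _∷_; _++_; length; filter; cartesianProduct; concatMap; map; allFin)
open import Data.List.Properties using (length-removeAt′; length-filter; filter-all; length-tabulate; length-++; concatMap-++)
open import Data.List.Relation.Unary.All as All using (All; []; _∷_; all?)
import Data.List.Relation.Unary.All.Properties as AllP
open import Data.List.Relation.Unary.Any as Any using (Any; here; there; any?; _─_; index)
import Data.List.Relation.Unary.Any.Properties as AnyP
open import Data.List.Relation.Unary.AllPairs using ([]; _∷_)
open import Data.List.Relation.Unary.Unique.Propositional using (Unique)
import Data.List.Relation.Unary.Unique.Propositional.Properties as UniqueP
import Data.List.Relation.Unary.Unique.DecPropositional as UniqueDec
open import Data.List.Membership.Propositional using (_∈_; find)
open import Data.List.Membership.Propositional.Properties
  using (∈-filter⁻; ∈-filter⁺; ∈-++⁻; ∈-concatMap⁺; ∈-concatMap⁻; ∈-map⁺; ∈-map⁻; ∈-allFin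
        ; ∈-cartesianProduct⁺)
import Data.List.Membership.DecPropositional as DecMembership
open import Data.List.Relation.Binary.Subset.Propositional using (_⊆_)
open import Data.List.Relation.Binary.Sublist.Propositional using ([]; _∷_; _∷ʳ_) renaming (_⊆_ to _⊑_; ⊆-refl to ⊑-refl)
open import Data.List.Relation.Binary.Sublist.Propositional.Properties using (All-resp-⊆; Any-resp-⊆; filter-⊆)
open import Data.Product using (Σ; _×_; _,_; proj₁; proj₂)
import Data.Product.Properties as Product
open import Data.Sum using (_⊎_; inj₁; inj₂)
import Data.Sum as Sum
open import Data.Empty using (⊥; ⊥-elim)
open import Relation.Nullary using (¬_; Dec; yes; no; ¬?; _×-dec_; _⊎-dec_; does)
open import Relation.Nullary.Decidable using (⌊_⌋)
open import Relation.Unary using (Decidable)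
open import Relation.Unary.Properties using (∁?)
open import Relation.Binary.Definitions using (DecidableEquality)
open import Relation.Binary.PropositionalEquality
  using (_≡_; _≢_; refl; sym; trans; cong; cong₂; subst; subst₂; module ≡-Reasoning)
open import Function.Bundles using (_⇔_; mk⇔; Equivalence)

halve-≤ : ∀ {a b} → a + a ≤ b + b → a ≤ b
halve-≤ {a} {b} 2a≤2b with a ≤? b
... | yes a≤b = a≤b
... | no  a≰b = ⊥-elim (<⇒≱ (+-mono-< (≰⇒> a≰b) (≰⇒> a≰b)) 2a≤2b)

module _ {a} {X : Set a} where

  ∈-─⁺ : ∀ {x w} {ys : List X} (p : x ∈ ys) → w ∈ ys → w ≢ x → w ∈ (ys ─ p)
  ∈-─⁺ (here refl) (here refl) w≢x = ⊥-elim (w≢x refl)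
  ∈-─⁺ (here refl) (there q)   _   = q
  ∈-─⁺ (there p)   (here refl) _   = here refl
  ∈-─⁺ (there p)   (there q)   w≢x = there (∈-─⁺ p q w≢x)

  length-─ : ∀ {x} {ys : List X} (p : x ∈ ys) → suc (length (ys ─ p)) ≡ length ys
  length-─ {ys = ys} p = sym (length-removeAt′ ys (index p))

  ─-⊑ : ∀ {x} {ys : List X} (p : x ∈ ys) → (ys ─ p) ⊑ ys
  ─-⊑ (here refl) = _ ∷ʳ ⊑-refl
  ─-⊑ (there p)   = refl ∷ ─-⊑ p

  Unique-⊑ : ∀ {xs ys : List X} → xs ⊑ ys → Unique ys → Unique xs
  Unique-⊑ []           _          = []
  Unique-⊑ (_ ∷ʳ xs⊑ys) (_ ∷ u)    = Unique-⊑ xs⊑ys u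
  Unique-⊑ (refl ∷ xs⊑ys) (y∉ ∷ u) = All-resp-⊆ xs⊑ys y∉ ∷ Unique-⊑ xs⊑ys u

  Unique-⊆⇒length-≤ : ∀ {xs ys : List X} → Unique xs → xs ⊆ ys → length xs ≤ length ys
  Unique-⊆⇒length-≤ {[]}     _            _    = z≤n
  Unique-⊆⇒length-≤ {x ∷ xs} {ys} (x∉xs ∷ uxs) xs⊆ys =
    subst (suc (length xs) ≤_) (length-─ x∈ys) (s≤s (Unique-⊆⇒length-≤ uxs xs⊆ys─x))
    where
    x∈ys : x ∈ ys
    x∈ys = xs⊆ys (here refl)
    xs⊆ys─x : xs ⊆ (ys ─ x∈ys)
    xs⊆ys─x w∈xs = ∈-─⁺ x∈ys (xs⊆ys (there w∈xs)) λ w≡x → All.lookup x∉xs w∈xs (sym w≡x)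

module _ {n : ℕ} where

  Pair : Set
  Pair = Fin n × Fin n

  covered? : ∀ (M : List Pair) v → Dec (Covered M v)
  covered? M v = v ∈? endpoints M
    where open DecMembership (_≟ᶠ_ {n}) using (_∈?_)

  covered-∷⁻ : ∀ {a b : Fin n} M {v} → Covered ((a , b) ∷ M) v → v ≡ a ⊎ v ≡ b ⊎ Covered M v
  covered-∷⁻ M (here eq)         = inj₁ eq
  covered-∷⁻ M (there (here eq)) = inj₂ (inj₁ eq)
  covered-∷⁻ M (there (there c)) = inj₂ (inj₂ c)

  length-endpoints : ∀ (M : List Pair) → length (endpoints M) ≡ length M + length M
  length-endpoints []      = refl
  length-endpoints (_ ∷ M) = cong suc (trans (cong suc (length-endpoints M)) (sym (+-suc _ _)))

  ∈⇒covered : ∀ {e : Pair} {M} → e ∈ M → Covered M (proj₁ e) × Covered M (proj₂ e)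
  ∈⇒covered (here refl) = here refl , there (here refl)
  ∈⇒covered (there p)   = there (there (proj₁ (∈⇒covered p))) , there (there (proj₂ (∈⇒covered p)))

  endpoints-⊑ : ∀ {M′ M : List Pair} → M′ ⊑ M → endpoints M′ ⊑ endpoints M
  endpoints-⊑ []             = []
  endpoints-⊑ (e ∷ʳ M′⊑M)    = proj₁ e ∷ʳ proj₂ e ∷ʳ endpoints-⊑ M′⊑M
  endpoints-⊑ (refl ∷ M′⊑M)  = refl ∷ refl ∷ endpoints-⊑ M′⊑M

  covered-⊑ : ∀ {M′ M : List Pair} {w} → M′ ⊑ M → Covered M′ w → Covered M w
  covered-⊑ M′⊑M = Any-resp-⊆ (endpoints-⊑ M′⊑M)

  InM-sym : ∀ {M : List Pair} {u v} → InM M u v → InM M v u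
  InM-sym (inj₁ p) = inj₂ p
  InM-sym (inj₂ p) = inj₁ p

  InM⇒coveredˡ : ∀ {M : List Pair} {u v} → InM M u v → Covered M u
  InM⇒coveredˡ (inj₁ p) = proj₁ (∈⇒covered p)
  InM⇒coveredˡ (inj₂ p) = proj₂ (∈⇒covered p)

  InM⇒coveredʳ : ∀ {M : List Pair} {u v} → InM M u v → Covered M v
  InM⇒coveredʳ uv = InM⇒coveredˡ (InM-sym uv)

  InM-there : ∀ {e : Pair} {M u v} → InM M u v → InM (e ∷ M) u v
  InM-there (inj₁ p) = inj₁ (there p)
  InM-there (inj₂ p) = inj₂ (there p)

  covered⇒InM : ∀ {M : List Pair} {v} → Covered M v → Σ (Fin n) (InM M v)
  covered⇒InM {e ∷ M} (here refl)         = proj₂ e , inj₁ (here refl)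
  covered⇒InM {e ∷ M} (there (here refl)) = proj₁ e , inj₂ (here refl)
  covered⇒InM {e ∷ M} (there (there c))   =
    let w , uv = covered⇒InM c in w , InM-there uv

  InM-∷⁻ : ∀ {e : Pair} {M u v} → InM (e ∷ M) u v →
           (u ≡ proj₁ e × v ≡ proj₂ e) ⊎ (u ≡ proj₂ e × v ≡ proj₁ e) ⊎ InM M u v
  InM-∷⁻ (inj₁ (here refl)) = inj₁ (refl , refl)
  InM-∷⁻ (inj₂ (here refl)) = inj₂ (inj₁ (refl , refl))
  InM-∷⁻ (inj₁ (there p))   = inj₂ (inj₂ (inj₁ p))
  InM-∷⁻ (inj₂ (there p))   = inj₂ (inj₂ (inj₂ p))

  InM-functional : ∀ {M : List Pair} {a b c} → Unique (endpoints M) → InM M a b → InM M a c → b ≡ c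
  InM-functional {[]} _ (inj₁ ()) _
  InM-functional {[]} _ (inj₂ ()) _
  InM-functional {e ∷ M} (e₁∉ ∷ e₂∉ ∷ u) ab ac with InM-∷⁻ ab | InM-∷⁻ ac
  ... | inj₁ (_ , refl)        | inj₁ (_ , refl)        = refl
  ... | inj₂ (inj₁ (_ , refl)) | inj₂ (inj₁ (_ , refl)) = refl
  ... | inj₁ (refl , _)        | inj₂ (inj₁ (a≡ , _))   = ⊥-elim (All.head e₁∉ a≡)
  ... | inj₂ (inj₁ (refl , _)) | inj₁ (a≡ , _)          = ⊥-elim (All.head e₁∉ (sym a≡))
  ... | inj₁ (refl , _)        | inj₂ (inj₂ ac′)        = ⊥-elim (All.lookup (All.tail e₁∉) (InM⇒coveredˡ ac′) refl)
  ... | inj₂ (inj₁ (refl , _)) | inj₂ (inj₂ ac′)        = ⊥-elim (All.lookup e₂∉ (InM⇒coveredˡ ac′) refl)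
  ... | inj₂ (inj₂ ab′)        | inj₁ (refl , _)        = ⊥-elim (All.lookup (All.tail e₁∉) (InM⇒coveredˡ ab′) refl)
  ... | inj₂ (inj₂ ab′)        | inj₂ (inj₁ (refl , _)) = ⊥-elim (All.lookup e₂∉ (InM⇒coveredˡ ab′) refl)
  ... | inj₂ (inj₂ ab′)        | inj₂ (inj₂ ac′)        = InM-functional u ab′ ac′

  covered-─-≢ : ∀ {e : Pair} {M w} (p : e ∈ M) → Unique (endpoints M) → Covered (M ─ p) w →
                w ≢ proj₁ e × w ≢ proj₂ e
  covered-─-≢ (here refl) (e₁∉ ∷ e₂∉ ∷ _) c =
    (λ { refl → All.lookup (All.tail e₁∉) c refl }) , (λ { refl → All.lookup e₂∉ c refl })
  covered-─-≢ (there p) (e₁∉ ∷ e₂∉ ∷ _) (here refl) =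
    (λ eq → All.lookup (All.tail e₁∉) (proj₁ (∈⇒covered p)) eq) ,
    (λ eq → All.lookup (All.tail e₁∉) (proj₂ (∈⇒covered p)) eq)
  covered-─-≢ (there p) (e₁∉ ∷ e₂∉ ∷ _) (there (here refl)) =
    (λ eq → All.lookup e₂∉ (proj₁ (∈⇒covered p)) eq) , (λ eq → All.lookup e₂∉ (proj₂ (∈⇒covered p)) eq)
  covered-─-≢ (there p) (_ ∷ _ ∷ u) (there (there c)) = covered-─-≢ p u c

  removeEdge : ∀ (M : List Pair) {a b} → InM M a b → List Pair
  removeEdge M (inj₁ p) = M ─ p
  removeEdge M (inj₂ p) = M ─ p

  length-removeEdge : ∀ M {a b} (ab : InM M a b) → suc (length (removeEdge M ab)) ≡ length M
  length-removeEdge M (inj₁ p) = length-─ p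
  length-removeEdge M (inj₂ p) = length-─ p

  removeEdge-⊑ : ∀ M {a b} (ab : InM M a b) → removeEdge M ab ⊑ M
  removeEdge-⊑ M (inj₁ p) = ─-⊑ p
  removeEdge-⊑ M (inj₂ p) = ─-⊑ p

  covered-removeEdge⁻ : ∀ M {a b w} (ab : InM M a b) → Covered (removeEdge M ab) w → Covered M w
  covered-removeEdge⁻ M ab = covered-⊑ (removeEdge-⊑ M ab)

  covered-removeEdge-≢ : ∀ M {a b w} (ab : InM M a b) → Unique (endpoints M) →
                         Covered (removeEdge M ab) w → w ≢ a × w ≢ b
  covered-removeEdge-≢ M (inj₁ p) u c = covered-─-≢ p u c
  covered-removeEdge-≢ M (inj₂ p) u c = let w≢b , w≢a = covered-─-≢ p u c in w≢a , w≢b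

  InM-removeEdge⁺ : ∀ M {a b c d} (ab : InM M a b) → InM M c d → c ≢ a → c ≢ b → InM (removeEdge M ab) c d
  InM-removeEdge⁺ M (inj₁ p) (inj₁ q) c≢a c≢b = inj₁ (∈-─⁺ p q λ eq → c≢a (cong proj₁ eq))
  InM-removeEdge⁺ M (inj₁ p) (inj₂ q) c≢a c≢b = inj₂ (∈-─⁺ p q λ eq → c≢b (cong proj₂ eq))
  InM-removeEdge⁺ M (inj₂ p) (inj₁ q) c≢a c≢b = inj₁ (∈-─⁺ p q λ eq → c≢b (cong proj₁ eq))
  InM-removeEdge⁺ M (inj₂ p) (inj₂ q) c≢a c≢b = inj₂ (∈-─⁺ p q λ eq → c≢a (cong proj₂ eq))

  infixl 20 _∖_
  _∖_ : VSet n → Fin n → VSet n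
  (S ∖ a) w = S w ∧ not ⌊ w ≟ᶠ a ⌋

  ∈-∖⁺ : ∀ S a {w} → w ∈ˢ S → w ≢ a → w ∈ˢ (S ∖ a)
  ∈-∖⁺ S a {w} w∈S w≢a with w ≟ᶠ a
  ... | yes w≡a = ⊥-elim (w≢a w≡a)
  ... | no  _   = trans (∧-identityʳ (S w)) w∈S

  ∈-∖⁻ : ∀ S a {w} → w ∈ˢ (S ∖ a) → w ∈ˢ S × w ≢ a
  ∈-∖⁻ S a {w} w∈S∖a with w ≟ᶠ a
  ... | yes _   with () ← trans (sym (∧-zeroʳ (S w))) w∈S∖a
  ... | no w≢a  = trans (sym (∧-identityʳ (S w))) w∈S∖a , w≢a

module Matchings {n : ℕ} (G : Graph n) where

  Edge-sym : ∀ {a b} → Edge G a b → Edge G b a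
  Edge-sym {a} {b} ab = trans (Graph.sym G b a) ab

  Edge⇒≢ : ∀ {a b} → Edge G a b → a ≢ b
  Edge⇒≢ {a} aa refl with trans (sym aa) (irrefl G a)
  ... | ()

  covered⇒∈S : ∀ {S M v} → IsMatching G S M → Covered M v → v ∈ˢ S
  covered⇒∈S (_ , (_ , a∈S , _) ∷ _) (here refl)         = a∈S
  covered⇒∈S (_ , (_ , _ , b∈S) ∷ _) (there (here refl)) = b∈S
  covered⇒∈S (_ ∷ _ ∷ u , _ ∷ es)    (there (there c))   = covered⇒∈S (u , es) c

  InM⇒Edge : ∀ {S M a b} → IsMatching G S M → InM M a b → Edge G a b
  InM⇒Edge (_ , es) (inj₁ p) = proj₁ (All.lookup es p)
  InM⇒Edge (_ , es) (inj₂ p) = Edge-sym (proj₁ (All.lookup es p))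

  isMatching-∷ : ∀ {S M a b} → IsMatching G S M → Edge G a b → a ∈ˢ S → b ∈ˢ S →
                 ¬ Covered M a → ¬ Covered M b → IsMatching G S ((a , b) ∷ M)
  isMatching-∷ (u , es) ab a∈S b∈S a∉M b∉M =
    ((Edge⇒≢ ab ∷ AllP.¬Any⇒All¬ _ a∉M) ∷ AllP.¬Any⇒All¬ _ b∉M ∷ u) , ((ab , a∈S , b∈S) ∷ es)

  isMatching-restrict : ∀ {S T M} → IsMatching G S M → (∀ {v} → Covered M v → v ∈ˢ T) → IsMatching G T M
  isMatching-restrict {M = []}    ([] , [])                   _   = [] , []
  isMatching-restrict {M = _ ∷ _} (a∉ ∷ b∉ ∷ u , (ab , _) ∷ es) M⊆T =
    let u′ , es′ = isMatching-restrict (u , es) (λ c → M⊆T (there (there c)))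
    in  a∉ ∷ b∉ ∷ u′ , (ab , M⊆T (here refl) , M⊆T (there (here refl))) ∷ es′

  isMatching-weaken : ∀ {S T M} → IsMatching G S M → (∀ {v} → v ∈ˢ S → v ∈ˢ T) → IsMatching G T M
  isMatching-weaken m S⊆T = isMatching-restrict m (λ c → S⊆T (covered⇒∈S m c))

  isMatching-⊑ : ∀ {S M M′} → M′ ⊑ M → IsMatching G S M → IsMatching G S M′
  isMatching-⊑ M′⊑M (u , es) = Unique-⊑ (endpoints-⊑ M′⊑M) u , All-resp-⊆ M′⊑M es

  isMatching-removeEdge : ∀ {S} M {a b} (ab : InM M a b) → IsMatching G S M → IsMatching G S (removeEdge M ab)
  isMatching-removeEdge M ab = isMatching-⊑ (removeEdge-⊑ M ab)

module Paths {n : ℕ} (G : Graph n) where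

  singletonPath : ∀ {S} v → v ∈ˢ S → Path G S
  singletonPath v v∈S = record
    { plen = 0 ; pvert = λ _ → v ; pinj = λ { fzero fzero _ → refl } ; pinS = λ _ → v∈S ; padj = λ () }

  consPath : ∀ {S} a (P : Path G S) → a ∈ˢ S → (∀ i → pvert P i ≢ a) → Edge G a (pvert P fzero) → Path G S
  consPath {S} a P a∈S a∉P a~P₀ = record
    { plen = suc (plen P) ; pvert = vert′ ; pinj = inj′ ; pinS = inS′ ; padj = adj′ }
    where
    vert′ : Fin (suc (suc (plen P))) → Fin n
    vert′ fzero    = a
    vert′ (fsuc i) = pvert P i
    inj′ : ∀ i j → vert′ i ≡ vert′ j → i ≡ j
    inj′ fzero    fzero    _  = refl
    inj′ fzero    (fsuc j) eq = ⊥-elim (a∉P j (sym eq))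
    inj′ (fsuc i) fzero    eq = ⊥-elim (a∉P i eq)
    inj′ (fsuc i) (fsuc j) eq = cong fsuc (pinj P i j eq)
    inS′ : ∀ i → vert′ i ∈ˢ S
    inS′ fzero    = a∈S
    inS′ (fsuc i) = pinS P i
    adj′ : ∀ i → Edge G (vert′ (inject₁ i)) (vert′ (fsuc i))
    adj′ fzero    = a~P₀
    adj′ (fsuc i) = padj P i

  EvenPath : ∀ (S : VSet n) (u v : Fin n) → Set
  EvenPath S u v = Σ (Path G S) λ P →
    pvert P fzero ≡ u × pvert P (fromℕ (plen P)) ≡ v × Σ ℕ λ s → plen P ≡ s + s

  weakenPath : ∀ {S T} → (∀ {v} → v ∈ˢ S → v ∈ˢ T) → Path G S → Path G T
  weakenPath S⊆T P = record
    { plen = plen P ; pvert = pvert P ; pinj = pinj P ; pinS = λ i → S⊆T (pinS P i) ; padj = padj P }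

-- Alternating paths and maximum matchings

module AlternatingPaths {n : ℕ} (G : Graph n) where
  open Matchings G
  open Paths G

  -- The symmetric difference of M with an even M-alternating path from y to a vertex missed by M.
  record Rerouting (S : VSet n) (M : List Pair) (y : Fin n) : Set where
    field
      matching     : List Pair
      free         : Fin n
      isMatching   : IsMatching G S matching
      length-≡     : length matching ≡ length M
      y∉matching   : ¬ Covered matching y
      y∈M⊎free     : Covered M y ⊎ y ≡ free
      covered⊆     : ∀ {w} → Covered matching w → Covered M w ⊎ w ≡ free
      path         : EvenPath S y free

  record Augmentation (S : VSet n) (N : List Pair) (y : Fin n) : Set where
    field
      matching   : List Pair
      other      : Fin n
      isMatching : IsMatching G S matching
      length-≡   : length matching ≡ suc (length N)
      covered⊆   : ∀ {w} → Covered matching w → Covered N w ⊎ w ≡ y ⊎ w ≡ other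

  trivialRerouting : ∀ {S M y} → IsMatching G S M → y ∈ˢ S → ¬ Covered M y → Rerouting S M y
  trivialRerouting {M = M} {y} isM y∈S y∉M = record
    { matching = M ; free = y ; isMatching = isM ; length-≡ = refl ; y∉matching = y∉M
    ; y∈M⊎free = inj₂ refl ; covered⊆ = inj₁ ; path = singletonPath y y∈S , refl , refl , 0 , refl }

  module AlternatingStep {S M N y y₁ y₂} (isM : IsMatching G S M) (isN : IsMatching G S N) (y∈S : y ∈ˢ S)
              (y∉N : ¬ Covered N y) (yy₁ : InM M y y₁) (y₁y₂ : InM N y₁ y₂) where

    S′ : VSet n
    S′ = S ∖ y ∖ y₁

    M′ N′ : List Pair
    M′ = removeEdge M yy₁
    N′ = removeEdge N y₁y₂

    y~y₁ : Edge G y y₁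
    y~y₁ = InM⇒Edge isM yy₁

    y₁~y₂ : Edge G y₁ y₂
    y₁~y₂ = InM⇒Edge isN y₁y₂

    y₁∈S : y₁ ∈ˢ S
    y₁∈S = covered⇒∈S isM (InM⇒coveredʳ yy₁)

    y₂∈S : y₂ ∈ˢ S
    y₂∈S = covered⇒∈S isN (InM⇒coveredʳ y₁y₂)

    y₂≢y : y₂ ≢ y
    y₂≢y refl = y∉N (InM⇒coveredʳ y₁y₂)

    S′⊆S : ∀ {w} → w ∈ˢ S′ → w ∈ˢ S
    S′⊆S w∈S′ = proj₁ (∈-∖⁻ S y (proj₁ (∈-∖⁻ (S ∖ y) y₁ w∈S′)))

    ∈S′⇒≢y : ∀ {w} → w ∈ˢ S′ → w ≢ y
    ∈S′⇒≢y w∈S′ = proj₂ (∈-∖⁻ S y (proj₁ (∈-∖⁻ (S ∖ y) y₁ w∈S′)))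

    ∈S′⇒≢y₁ : ∀ {w} → w ∈ˢ S′ → w ≢ y₁
    ∈S′⇒≢y₁ w∈S′ = proj₂ (∈-∖⁻ (S ∖ y) y₁ w∈S′)

    ∈S′ : ∀ {w} → w ∈ˢ S → w ≢ y → w ≢ y₁ → w ∈ˢ S′
    ∈S′ w∈S w≢y w≢y₁ = ∈-∖⁺ (S ∖ y) y₁ (∈-∖⁺ S y w∈S w≢y) w≢y₁

    y₂∈S′ : y₂ ∈ˢ S′
    y₂∈S′ = ∈S′ y₂∈S y₂≢y (λ eq → Edge⇒≢ y₁~y₂ (sym eq))

    isM′ : IsMatching G S′ M′
    isM′ = isMatching-restrict (isMatching-removeEdge M yy₁ isM) λ c →
      let w≢y , w≢y₁ = covered-removeEdge-≢ M yy₁ (proj₁ isM) c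
      in  ∈S′ (covered⇒∈S isM (covered-removeEdge⁻ M yy₁ c)) w≢y w≢y₁

    isN′ : IsMatching G S′ N′
    isN′ = isMatching-restrict (isMatching-removeEdge N y₁y₂ isN) λ c →
      let w∈N = covered-removeEdge⁻ N y₁y₂ c
      in  ∈S′ (covered⇒∈S isN w∈N) (λ { refl → y∉N w∈N }) (proj₁ (covered-removeEdge-≢ N y₁y₂ (proj₁ isN) c))

    y₂∉N′ : ¬ Covered N′ y₂
    y₂∉N′ c = proj₂ (covered-removeEdge-≢ N y₁y₂ (proj₁ isN) c) refl

    extendRerouting : Rerouting S′ M′ y₂ → Rerouting S M y
    extendRerouting R = record
      { matching = (y₁ , y₂) ∷ R.matching
      ; free = R.free
      ; isMatching = isMatching-∷ (isMatching-weaken R.isMatching S′⊆S) y₁~y₂ y₁∈S y₂∈S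
                       (λ c → ∈S′⇒≢y₁ (covered⇒∈S R.isMatching c) refl) R.y∉matching
      ; length-≡ = trans (cong suc R.length-≡) (length-removeEdge M yy₁)
      ; y∉matching = y∉
      ; y∈M⊎free = inj₁ (InM⇒coveredˡ yy₁)
      ; covered⊆ = covered⊆
      ; path = path
      }
      where
      module R = Rerouting R
      y∉ : ¬ Covered ((y₁ , y₂) ∷ R.matching) y
      y∉ c with covered-∷⁻ R.matching c
      ... | inj₁ refl        = Edge⇒≢ y~y₁ refl
      ... | inj₂ (inj₁ y≡y₂) = y₂≢y (sym y≡y₂)
      ... | inj₂ (inj₂ c′)   = ∈S′⇒≢y (covered⇒∈S R.isMatching c′) refl
      covered⊆ : ∀ {w} → Covered ((y₁ , y₂) ∷ R.matching) w → Covered M w ⊎ w ≡ R.free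
      covered⊆ c with covered-∷⁻ R.matching c
      ... | inj₁ refl      = inj₁ (InM⇒coveredʳ yy₁)
      ... | inj₂ (inj₁ refl) = Sum.map₁ (covered-removeEdge⁻ M yy₁) R.y∈M⊎free
      ... | inj₂ (inj₂ c′) = Sum.map₁ (covered-removeEdge⁻ M yy₁) (R.covered⊆ c′)
      path : EvenPath S y R.free
      path with R.path
      ... | P , refl , P-end , s , P-even =
        consPath y (consPath y₁ (weakenPath S′⊆S P) y₁∈S (λ i → ∈S′⇒≢y₁ (pinS P i)) y₁~y₂)
          y∈S (λ { fzero → λ eq → Edge⇒≢ y~y₁ (sym eq) ; (fsuc i) → ∈S′⇒≢y (pinS P i) })
          y~y₁ ,
        refl , P-end , suc s , cong suc (trans (cong suc P-even) (sym (+-suc s s)))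

    extendAugmentation : Augmentation S′ N′ y₂ → Augmentation S N y
    extendAugmentation A = record
      { matching = (y , y₁) ∷ A.matching
      ; other = A.other
      ; isMatching = isMatching-∷ (isMatching-weaken A.isMatching S′⊆S) y~y₁ y∈S y₁∈S
                       (λ c → ∈S′⇒≢y (covered⇒∈S A.isMatching c) refl)
                       (λ c → ∈S′⇒≢y₁ (covered⇒∈S A.isMatching c) refl)
      ; length-≡ = cong suc (trans A.length-≡ (length-removeEdge N y₁y₂))
      ; covered⊆ = covered⊆
      }
      where
      module A = Augmentation A
      covered⊆ : ∀ {w} → Covered ((y , y₁) ∷ A.matching) w → Covered N w ⊎ w ≡ y ⊎ w ≡ A.other
      covered⊆ c with covered-∷⁻ A.matching c
      ... | inj₁ refl          = inj₂ (inj₁ refl)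
      ... | inj₂ (inj₁ refl)   = inj₁ (InM⇒coveredˡ y₁y₂)
      ... | inj₂ (inj₂ c′) with A.covered⊆ c′
      ...   | inj₁ c″          = inj₁ (covered-removeEdge⁻ N y₁y₂ c″)
      ...   | inj₂ (inj₁ refl) = inj₁ (InM⇒coveredʳ y₁y₂)
      ...   | inj₂ (inj₂ eq)   = inj₂ (inj₂ eq)

  augmentByEdge : ∀ {S M N y y₁} → IsMatching G S M → IsMatching G S N → y ∈ˢ S →
                  ¬ Covered N y → InM M y y₁ → ¬ Covered N y₁ → Augmentation S N y
  augmentByEdge {N = N} {y} {y₁} isM isN y∈S y∉N yy₁ y₁∉N = record
    { matching = (y , y₁) ∷ N ; other = y₁
    ; isMatching = isMatching-∷ isN (InM⇒Edge isM yy₁) y∈S (covered⇒∈S isM (InM⇒coveredʳ yy₁)) y∉N y₁∉N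
    ; length-≡ = refl
    ; covered⊆ = λ c → reorder (covered-∷⁻ N c)
    }
    where
    reorder : ∀ {A B C : Set} → A ⊎ B ⊎ C → C ⊎ A ⊎ B
    reorder (inj₁ a)        = inj₂ (inj₁ a)
    reorder (inj₂ (inj₁ b)) = inj₂ (inj₂ b)
    reorder (inj₂ (inj₂ c)) = inj₁ c

  -- Walk alternately along M and N from y; it ends either at a vertex missed by M or by N.
  rerouteOrAugment : ∀ fuel {S M N y} → length M ≤ fuel → IsMatching G S M → IsMatching G S N →
                     y ∈ˢ S → ¬ Covered N y → Rerouting S M y ⊎ Augmentation S N y
  rerouteOrAugment zero {M = []} _ isM _ y∈S _ = inj₁ (trivialRerouting isM y∈S λ ())
  rerouteOrAugment (suc fuel) {S} {M} {N} {y} |M|≤ isM isN y∈S y∉N with covered? M y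
  ... | no y∉M = inj₁ (trivialRerouting isM y∈S y∉M)
  ... | yes y∈M with covered⇒InM y∈M
  ...   | y₁ , yy₁ with covered? N y₁
  ...     | no y₁∉N = inj₂ (augmentByEdge isM isN y∈S y∉N yy₁ y₁∉N)
  ...     | yes y₁∈N with covered⇒InM y₁∈N
  ...       | y₂ , y₁y₂ =
    Sum.map extendRerouting extendAugmentation
      (rerouteOrAugment fuel |M′|≤ isM′ isN′ y₂∈S′ y₂∉N′)
    where
    open AlternatingStep isM isN y∈S y∉N yy₁ y₁y₂
    |M′|≤ : length M′ ≤ fuel
    |M′|≤ = ≤-pred (subst (_≤ suc fuel) (sym (length-removeEdge M yy₁)) |M|≤)

  noLargerMatching : ∀ {S M M′} → IsMaxMatching G S M → IsMatching G S M′ → length M′ ≡ suc (length M) → ⊥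
  noLargerMatching {M′ = M′} (_ , max) isM′ |M′|≡ = <-irrefl refl (subst (_≤ _) |M′|≡ (max M′ isM′))

  isMaxMatching-≡ : ∀ {S M M′} → IsMaxMatching G S M → IsMatching G S M′ → length M′ ≡ length M →
                    IsMaxMatching G S M′
  isMaxMatching-≡ (_ , max) isM′ |M′|≡ = isM′ , λ L isL → subst (length L ≤_) (sym |M′|≡) (max L isL)

  -- Rerouting Mv away from u must end at v: otherwise the edge uv would enlarge the rerouted matching.
  evenPathBetween : ∀ {S u v} → D G S u → D G S v → Edge G u v → EvenPath S u v
  evenPathBetween {S} {u} {v} (u∈S , Mu , maxMu , u∉Mu) (v∈S , Mv , maxMv , v∉Mv) u~v
    with rerouteOrAugment (length Mv) ≤-refl (proj₁ maxMv) (proj₁ maxMu) u∈S u∉Mu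
  ... | inj₂ A = ⊥-elim (noLargerMatching maxMu (Augmentation.isMatching A) (Augmentation.length-≡ A))
  ... | inj₁ R = endsAt-v
    where
    module R = Rerouting R
    endsAt-v : EvenPath S u v
    endsAt-v with R.free ≟ᶠ v
    ... | yes refl  = R.path
    ... | no free≢v = ⊥-elim (noLargerMatching maxMv
                        (isMatching-∷ R.isMatching u~v u∈S v∈S R.y∉matching v∉R) (cong suc R.length-≡))
      where
      v∉R : ¬ Covered R.matching v
      v∉R c with R.covered⊆ c
      ... | inj₁ v∈Mv   = v∉Mv v∈Mv
      ... | inj₂ v≡free = free≢v (sym v≡free)

  dropVertex : Fin n → List (Fin n) → List (Fin n)
  dropVertex z = filter (λ x → ¬? (x ≟ᶠ z))

  length-dropVertex : ∀ z (xs : List (Fin n)) → Unique xs → length xs ≤ suc (length (dropVertex z xs))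
  length-dropVertex z []       _            = z≤n
  length-dropVertex z (x ∷ xs) (x∉xs ∷ uxs) with x ≟ᶠ z
  ... | yes refl = s≤s (ℕ.≤-reflexive (cong length (sym (filter-all (λ w → ¬? (w ≟ᶠ z))
                     (All.map (λ z≢w w≡z → z≢w (sym w≡z)) x∉xs)))))
  ... | no  _    = s≤s (length-dropVertex z xs uxs)

  -- For each y in Y, either M can be rerouted to miss y, so y ∈ D, or N augments to cover y and one more vertex.
  unmatchedBound : ∀ fuel {S M N} (Y : List (Fin n)) → length Y ≤ fuel →
                   IsMaxMatching G S M → IsMatching G S N →
                   Unique Y → All (_∈ˢ S) Y → All (λ y → ¬ Covered N y) Y →
                   length N + length N + length Y ≤ length M + length M ⊎ Any (D G S) Y
  unmatchedBound _ {M = M} [] _ (_ , max) isN _ _ _ =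
    inj₁ (subst (_≤ length M + length M) (sym (ℕ.+-identityʳ _)) (+-mono-≤ (max _ isN) (max _ isN)))
  unmatchedBound (suc fuel) {S} {M} {N} (y ∷ Y) |Y|≤ maxM isN (y∉Y ∷ uY) (y∈S ∷ Y⊆S) (y∉N ∷ Y∉N)
    with rerouteOrAugment (length M) ≤-refl (proj₁ maxM) isN y∈S y∉N
  ... | inj₁ R = inj₂ (here (y∈S , R.matching , isMaxMatching-≡ maxM R.isMatching R.length-≡ , R.y∉matching))
    where module R = Rerouting R
  ... | inj₂ A = Sum.map bound (λ d → there (AnyP.filter⁻ _ d))
                   (unmatchedBound fuel Y′ |Y′|≤ maxM A.isMatching
                      (UniqueP.filter⁺ _ uY) (All.tabulate (λ w∈Y′ → All.lookup Y⊆S (proj₁ (∈-filter⁻ _ w∈Y′))))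
                      (All.tabulate Y′∉A))
    where
    module A = Augmentation A
    Y′ : List (Fin n)
    Y′ = dropVertex A.other Y
    |Y′|≤ : length Y′ ≤ fuel
    |Y′|≤ = ≤-trans (length-filter _ Y) (≤-pred |Y|≤)
    Y′∉A : ∀ {w} → w ∈ Y′ → ¬ Covered A.matching w
    Y′∉A w∈Y′ c with ∈-filter⁻ _ w∈Y′ | A.covered⊆ c
    ... | w∈Y , _    | inj₁ w∈N          = All.lookup Y∉N w∈Y w∈N
    ... | w∈Y , _    | inj₂ (inj₁ refl)  = All.lookup y∉Y w∈Y refl
    ... | _ , w≢other | inj₂ (inj₂ w≡other) = w≢other w≡other
    bound : length A.matching + length A.matching + length Y′ ≤ length M + length M →
            length N + length N + suc (length Y) ≤ length M + length M
    bound ≤M = ≤-trans (+-monoʳ-≤ (length N + length N) (s≤s (length-dropVertex A.other Y uY)))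
                 (subst (_≤ length M + length M)
                    (trans (cong (λ k → k + k + length Y′) A.length-≡) (shift (length N) (length Y′))) ≤M)
      where
      shift : ∀ a b → suc a + suc a + b ≡ a + a + suc (suc b)
      shift = solve 2 (λ a b → (con 1 :+ a) :+ (con 1 :+ a) :+ b := a :+ a :+ (con 2 :+ b)) refl

module MaximumMatchings {n : ℕ} (G : Graph n) where
  open Matchings G

  allPairs : List Pair
  allPairs = cartesianProduct (allFin n) (allFin n)

  listsOfLength : ℕ → List (List Pair)
  listsOfLength zero    = [] ∷ []
  listsOfLength (suc m) = concatMap (λ e → map (e ∷_) (listsOfLength m)) allPairs

  ∈-listsOfLength : ∀ (M : List Pair) → M ∈ listsOfLength (length M)
  ∈-listsOfLength []            = here refl
  ∈-listsOfLength ((a , b) ∷ M) =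
    ∈-concatMap⁺ (λ e → map (e ∷_) (listsOfLength (length M)))
      (Any.map (λ { refl → ∈-map⁺ ((a , b) ∷_) (∈-listsOfLength M) }) (∈-cartesianProduct⁺ (∈-allFin a) (∈-allFin b)))

  isMatching? : ∀ S M → Dec (IsMatching G S M)
  isMatching? S M = UniqueDec.unique? _≟ᶠ_ (endpoints M)
               ×-dec all? (λ (a , b) → (adj G a b ≟ᵇ true) ×-dec (S a ≟ᵇ true) ×-dec (S b ≟ᵇ true)) M

  matchingOfLength? : ∀ S m → Dec (Σ (List Pair) λ M → IsMatching G S M × length M ≡ m)
  matchingOfLength? S m with any? (λ M → isMatching? S M ×-dec (length M ℕ.≟ m)) (listsOfLength m)
  ... | yes found = yes (Any.satisfied found)
  ... | no none   = no λ { (M , isM , refl) → none (Any.map (λ { refl → isM , refl }) (∈-listsOfLength M)) }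

  length-matching≤n : ∀ {S M} → IsMatching G S M → length M ≤ n
  length-matching≤n {M = M} (u , _) = m+n≤o⇒m≤o (length M)
    (subst (_≤ n) (length-endpoints M)
      (subst (length (endpoints M) ≤_) (length-tabulate (λ i → i))
        (Unique-⊆⇒length-≤ u (λ {w} _ → ∈-allFin w))))

  maximumMatchingBelow : ∀ S m → (∀ M → IsMatching G S M → length M ≤ m) → Σ (List Pair) (IsMaxMatching G S)
  maximumMatchingBelow S m ≤m with matchingOfLength? S m
  ... | yes (M , isM , refl) = M , isM , ≤m
  maximumMatchingBelow S zero    ≤m | no _    = [] , ([] , []) , ≤m
  maximumMatchingBelow S (suc m) ≤m | no none =
    maximumMatchingBelow S m λ M isM → ≤-pred (≤∧≢⇒< (≤m M isM) (λ eq → none (M , isM , eq)))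

  maximumMatching : ∀ S → Σ (List Pair) (IsMaxMatching G S)
  maximumMatching S = maximumMatchingBelow S n (λ _ → length-matching≤n)

-- Graphs partitioned into pieces

module _ {A : Set} where

  length-filter+filter-∁ : ∀ {P : A → Set} (P? : Decidable P) xs →
                           length (filter P? xs) + length (filter (∁? P?) xs) ≡ length xs
  length-filter+filter-∁ P? []       = refl
  length-filter+filter-∁ P? (x ∷ xs) with does (P? x)
  ... | true  = cong suc (length-filter+filter-∁ P? xs)
  ... | false = trans (+-suc _ _) (cong suc (length-filter+filter-∁ P? xs))

  sum-map-+ : ∀ (xs : List A) (f g : A → ℕ) → sum (map (λ x → f x + g x) xs) ≡ sum (map f xs) + sum (map g xs)
  sum-map-+ []       f g = refl
  sum-map-+ (x ∷ xs) f g = trans (cong (f x + g x +_) (sum-map-+ xs f g)) (+-interchange (f x) (g x) _ _)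

  sum-map-mono-≤ : ∀ (xs : List A) {f g : A → ℕ} → (∀ x → f x ≤ g x) → sum (map f xs) ≤ sum (map g xs)
  sum-map-mono-≤ []       f≤g = z≤n
  sum-map-mono-≤ (x ∷ xs) f≤g = +-mono-≤ (f≤g x) (sum-map-mono-≤ xs f≤g)

  sum-map-mono-< : ∀ {xs : List A} {f g : A → ℕ} {x} → (∀ x → f x ≤ g x) → x ∈ xs → f x < g x →
                   sum (map f xs) < sum (map g xs)
  sum-map-mono-< {_ ∷ xs} f≤g (here refl)  fx<gx = +-mono-<-≤ fx<gx (sum-map-mono-≤ xs f≤g)
  sum-map-mono-< {y ∷ _}  f≤g (there x∈xs) fx<gx = +-mono-≤-< (f≤g y) (sum-map-mono-< f≤g x∈xs fx<gx)

  sum-map-cong : ∀ (xs : List A) {f g : A → ℕ} → All (λ x → f x ≡ g x) xs → sum (map f xs) ≡ sum (map g xs)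
  sum-map-cong []       []           = refl
  sum-map-cong (x ∷ xs) (fx≡gx ∷ eqs) = cong₂ _+_ fx≡gx (sum-map-cong xs eqs)

  sum-map-zero : ∀ (xs : List A) → sum (map (λ _ → 0) xs) ≡ 0
  sum-map-zero []       = refl
  sum-map-zero (_ ∷ xs) = sum-map-zero xs

  sum-map-suc-at : ∀ {xs : List A} {f g : A → ℕ} {x} → Unique xs → x ∈ xs →
                   g x ≡ suc (f x) → (∀ y → y ≢ x → g y ≡ f y) → sum (map g xs) ≡ suc (sum (map f xs))
  sum-map-suc-at {_ ∷ xs} (x∉xs ∷ _) (here refl) gx≡ g≡f =
    cong₂ _+_ gx≡ (sum-map-cong xs (All.map (λ {y} x≢y → g≡f y (λ y≡x → x≢y (sym y≡x))) x∉xs))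
  sum-map-suc-at {y ∷ _} (y∉xs ∷ u) (there x∈xs) gx≡ g≡f =
    trans (cong₂ _+_ (g≡f y (λ { refl → All.lookup y∉xs x∈xs refl })) (sum-map-suc-at u x∈xs gx≡ g≡f))
          (+-suc _ _)

module Partition {n : ℕ} (G : Graph n) {P : Set} (_≟ₚ_ : DecidableEquality P) (part : Fin n → P) where
  open Matchings G
  open AlternatingPaths G
  open MaximumMatchings G

  class : P → VSet n
  class p v = ⌊ part v ≟ₚ p ⌋

  ∈-class⁺ : ∀ {p v} → part v ≡ p → v ∈ˢ class p
  ∈-class⁺ {p} {v} eq with part v ≟ₚ p
  ... | yes _  = refl
  ... | no neq = ⊥-elim (neq eq)

  ∈-class⁻ : ∀ {p v} → v ∈ˢ class p → part v ≡ p
  ∈-class⁻ {p} {v} v∈p with part v ≟ₚ p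
  ... | yes eq = eq

  endpointsIn : P → List Pair → List (Fin n)
  endpointsIn p M = filter (λ w → part w ≟ₚ p) (endpoints M)

  inClass? : (p : P) → Decidable (λ (e : Pair) → part (proj₁ e) ≡ p × part (proj₂ e) ≡ p)
  inClass? p e = part (proj₁ e) ≟ₚ p ×-dec part (proj₂ e) ≟ₚ p

  edgesIn : P → List Pair → List Pair
  edgesIn p = filter (inClass? p)

  covered-edgesIn⁻ : ∀ {p} M {w} → Covered (edgesIn p M) w → part w ≡ p
  covered-edgesIn⁻ {p} M c with covered⇒InM {M = edgesIn p M} c
  ... | _ , inj₁ wx = proj₁ (proj₂ (∈-filter⁻ (inClass? p) {xs = M} wx))
  ... | _ , inj₂ xw = proj₂ (proj₂ (∈-filter⁻ (inClass? p) {xs = M} xw))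

  InM-edgesIn⁺ : ∀ {p M a b} → InM M a b → part a ≡ p → part b ≡ p → InM (edgesIn p M) a b
  InM-edgesIn⁺ {p} (inj₁ ab) a∈p b∈p = inj₁ (∈-filter⁺ (inClass? p) ab (a∈p , b∈p))
  InM-edgesIn⁺ {p} (inj₂ ba) a∈p b∈p = inj₂ (∈-filter⁺ (inClass? p) ba (b∈p , a∈p))

  isMatching-edgesIn : ∀ {p M} → IsMatching G full M → IsMatching G (class p) (edgesIn p M)
  isMatching-edgesIn {p} {M} isM =
    isMatching-restrict (isMatching-⊑ (filter-⊆ (inClass? p) M) isM) (λ c → ∈-class⁺ (covered-edgesIn⁻ M c))

  countByPart : ∀ (ps : List P) → Unique ps → (∀ p → p ∈ ps) → ∀ (ws : List (Fin n)) →
                sum (map (λ p → length (filter (λ w → part w ≟ₚ p) ws)) ps) ≡ length ws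
  countByPart ps _ _ [] = sum-map-zero ps
  countByPart ps u ∈ps (w ∷ ws) =
    trans (sum-map-suc-at u (∈ps (part w)) counted-at-part-w counted-elsewhere) (cong suc (countByPart ps u ∈ps ws))
    where
    count : P → List (Fin n) → ℕ
    count p vs = length (filter (λ v → part v ≟ₚ p) vs)
    counted-at-part-w : count (part w) (w ∷ ws) ≡ suc (count (part w) ws)
    counted-at-part-w with part w ≟ₚ part w
    ... | yes _  = refl
    ... | no neq = ⊥-elim (neq refl)
    counted-elsewhere : ∀ p → p ≢ part w → count p (w ∷ ws) ≡ count p ws
    counted-elsewhere p p≢ with part w ≟ₚ p
    ... | yes eq = ⊥-elim (p≢ (sym eq))
    ... | no  _  = refl

  ClassMaximumMatchings : Set
  ClassMaximumMatchings = (p : P) → Σ (List Pair) (IsMaxMatching G (class p))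

  replaceAt : ∀ q → Σ (List Pair) (IsMaxMatching G (class q)) → ClassMaximumMatchings
  replaceAt q m p with p ≟ₚ q
  ... | yes refl = m
  ... | no  _    = maximumMatching (class p)

  replaceAt-self : ∀ q m → proj₁ (replaceAt q m q) ≡ proj₁ m
  replaceAt-self q m with q ≟ₚ q
  ... | yes refl = refl
  ... | no  q≢q  = ⊥-elim (q≢q refl)

  module _ (parts : List P) (parts-unique : Unique parts) (∈-parts : ∀ p → p ∈ parts)
           (crossing : ∀ {u v} → Edge G u v → part u ≢ part v → ¬ D G (class (part u)) u) where

    Σₚ : (P → ℕ) → ℕ
    Σₚ f = sum (map f parts)

    module ClassBound (p : P) {M} (isM : IsMatching G full M) where

      N : List Pair
      N = edgesIn p M

      matchedAcross : List (Fin n)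
      matchedAcross = filter (λ w → ¬? (covered? N w)) (endpointsIn p M)

      ∈-matchedAcross⁻ : ∀ {w} → w ∈ matchedAcross → (Covered M w × part w ≡ p) × ¬ Covered N w
      ∈-matchedAcross⁻ w∈ = let w∈E , w∉N = ∈-filter⁻ (λ w → ¬? (covered? N w)) w∈
                            in  ∈-filter⁻ (λ w → part w ≟ₚ p) w∈E , w∉N

      matchedAcross∉D : ∀ {w} → w ∈ matchedAcross → ¬ D G (class p) w
      matchedAcross∉D w∈ with ∈-matchedAcross⁻ w∈
      ... | (w∈M , refl) , w∉N with covered⇒InM w∈M
      ...   | x , wx with part x ≟ₚ part _
      ...     | yes x∈p = ⊥-elim (w∉N (InM⇒coveredˡ (InM-edgesIn⁺ wx refl x∈p)))
      ...     | no  x∉p = crossing (InM⇒Edge isM wx) (λ eq → x∉p (sym eq))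

      Unique-endpointsIn : Unique (endpointsIn p M)
      Unique-endpointsIn = UniqueP.filter⁺ _ (proj₁ isM)

      length-endpointsIn : length (endpointsIn p M) ≤ length N + length N + length matchedAcross
      length-endpointsIn = begin
        length (endpointsIn p M)
          ≡⟨ sym (length-filter+filter-∁ (covered? N) (endpointsIn p M)) ⟩
        length (filter (covered? N) (endpointsIn p M)) + length matchedAcross
          ≤⟨ +-monoˡ-≤ (length matchedAcross) (subst (length (filter (covered? N) (endpointsIn p M)) ≤_) (length-endpoints N)
               (Unique-⊆⇒length-≤ (UniqueP.filter⁺ (covered? N) Unique-endpointsIn)
                  (λ w∈ → proj₂ (∈-filter⁻ (covered? N) {xs = endpointsIn p M} w∈)))) ⟩
        length N + length N + length matchedAcross                 ∎
        where open ≤-Reasoning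

      classBound : ∀ {Mₚ} → IsMaxMatching G (class p) Mₚ → (vs : List (Fin n)) → Unique vs →
                   All (_∈ˢ class p) vs → All (λ v → ¬ Covered M v) vs →
                   length (endpointsIn p M) + length vs ≤ length Mₚ + length Mₚ ⊎ Any (D G (class p)) vs
      classBound {Mₚ} maxMₚ vs uvs vs∈p vs∉M
        with unmatchedBound _ (vs ++ matchedAcross) ≤-refl maxMₚ (isMatching-edgesIn isM)
               (UniqueP.++⁺ uvs (UniqueP.filter⁺ _ Unique-endpointsIn)
                  (λ (v∈vs , v∈A) → All.lookup vs∉M v∈vs (proj₁ (proj₁ (∈-matchedAcross⁻ v∈A)))))
               (AllP.++⁺ vs∈p (All.tabulate λ w∈ → ∈-class⁺ (proj₂ (proj₁ (∈-matchedAcross⁻ w∈)))))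
               (AllP.++⁺ (All.map (λ v∉M c → v∉M (covered-⊑ (filter-⊆ (inClass? p) M) c)) vs∉M)
                         (All.tabulate λ w∈ → proj₂ (∈-matchedAcross⁻ w∈)))
      ... | inj₂ d with AnyP.++⁻ vs d
      ...   | inj₁ d-vs = inj₂ d-vs
      ...   | inj₂ d-across = let _ , w∈ , dw = find d-across in ⊥-elim (matchedAcross∉D w∈ dw)
      classBound {Mₚ} maxMₚ vs uvs vs∈p vs∉M | inj₁ bound = inj₁ (begin
        length (endpointsIn p M) + length vs                          ≤⟨ +-monoˡ-≤ (length vs) length-endpointsIn ⟩
        length N + length N + length matchedAcross + length vs        ≡⟨ +-assoc (length N + length N) _ _ ⟩
        length N + length N + (length matchedAcross + length vs)      ≡⟨ cong (length N + length N +_)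
                                                                          (trans (+-comm _ (length vs)) (sym (length-++ vs))) ⟩
        length N + length N + length (vs ++ matchedAcross)            ≤⟨ bound ⟩
        length Mₚ + length Mₚ                                         ∎)
        where open ≤-Reasoning

    endpointsIn-bound : ∀ p {M Mₚ} → IsMatching G full M → IsMaxMatching G (class p) Mₚ →
                        length (endpointsIn p M) ≤ length Mₚ + length Mₚ
    endpointsIn-bound p isM maxMₚ with ClassBound.classBound p isM maxMₚ [] [] [] []
    ... | inj₁ bound = subst (_≤ _) (+-identityʳ _) bound

    twice-length-≡ : ∀ M → length M + length M ≡ Σₚ (λ p → length (endpointsIn p M))
    twice-length-≡ M = trans (sym (length-endpoints M)) (sym (countByPart parts parts-unique ∈-parts (endpoints M)))

    module Union (fam : ClassMaximumMatchings) where

      Mₚ : P → List Pair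
      Mₚ p = proj₁ (fam p)

      ⋃ : List Pair
      ⋃ = concatMap Mₚ parts

      covered-Mₚ⁻ : ∀ {p w} → Covered (Mₚ p) w → part w ≡ p
      covered-Mₚ⁻ {p} c = ∈-class⁻ (covered⇒∈S (proj₁ (proj₂ (fam p))) c)

      covered-concatMap⁻ : ∀ ps {w} → Covered (concatMap Mₚ ps) w → Σ P λ q → q ∈ ps × Covered (Mₚ q) w
      covered-concatMap⁻ (q ∷ ps) {w} c
        with ∈-++⁻ (endpoints (Mₚ q)) (subst (w ∈_) (concatMap-++ _ (Mₚ q) (concatMap Mₚ ps)) c)
      ... | inj₁ w∈q  = q , here refl , w∈q
      ... | inj₂ w∈ps = let r , r∈ps , w∈r = covered-concatMap⁻ ps w∈ps in r , there r∈ps , w∈r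

      covered-⋃⁻ : ∀ {w} → Covered ⋃ w → Covered (Mₚ (part w)) w
      covered-⋃⁻ c with covered-concatMap⁻ parts c
      ... | _ , _ , w∈q = subst (λ q → Covered (Mₚ q) _) (sym (covered-Mₚ⁻ w∈q)) w∈q

      Unique-endpoints-concatMap : ∀ ps → Unique ps → Unique (endpoints (concatMap Mₚ ps))
      Unique-endpoints-concatMap []       _           = []
      Unique-endpoints-concatMap (q ∷ ps) (q∉ps ∷ u) =
        subst Unique (sym (concatMap-++ _ (Mₚ q) (concatMap Mₚ ps)))
          (UniqueP.++⁺ (proj₁ (proj₁ (proj₂ (fam q)))) (Unique-endpoints-concatMap ps u) disjoint)
        where
        disjoint : ∀ {w} → ¬ (Covered (Mₚ q) w × Covered (concatMap Mₚ ps) w)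
        disjoint (w∈q , w∈ps) = let r , r∈ps , w∈r = covered-concatMap⁻ ps w∈ps
                                in  All.lookup q∉ps r∈ps (trans (sym (covered-Mₚ⁻ w∈q)) (covered-Mₚ⁻ w∈r))

      length-concatMap : ∀ ps → length (concatMap Mₚ ps) ≡ sum (map (λ p → length (Mₚ p)) ps)
      length-concatMap []       = refl
      length-concatMap (q ∷ ps) = trans (length-++ (Mₚ q)) (cong (length (Mₚ q) +_) (length-concatMap ps))

      isMatching-⋃ : IsMatching G full ⋃
      isMatching-⋃ = Unique-endpoints-concatMap parts parts-unique , All.tabulate edge
        where
        edge : ∀ {e} → e ∈ ⋃ → Edge G (proj₁ e) (proj₂ e) × proj₁ e ∈ˢ full × proj₂ e ∈ˢ full
        edge e∈ = let q , _ , e∈q = find (∈-concatMap⁻ Mₚ {xs = parts} e∈)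
                  in  proj₁ (All.lookup (proj₂ (proj₁ (proj₂ (fam q)))) e∈q) , refl , refl

      twice-length-⋃ : Σₚ (λ p → length (Mₚ p) + length (Mₚ p)) ≡ length ⋃ + length ⋃
      twice-length-⋃ = trans (sum-map-+ parts _ _) (sym (cong₂ _+_ (length-concatMap parts) (length-concatMap parts)))

      twice-length≤ : ∀ {M} → IsMatching G full M → length M + length M ≤ length ⋃ + length ⋃
      twice-length≤ {M} isM = begin
        length M + length M                              ≡⟨ twice-length-≡ M ⟩
        Σₚ (λ p → length (endpointsIn p M))
          ≤⟨ sum-map-mono-≤ parts (λ p → endpointsIn-bound p isM (proj₂ (fam p))) ⟩
        Σₚ (λ p → length (Mₚ p) + length (Mₚ p))         ≡⟨ twice-length-⋃ ⟩
        length ⋃ + length ⋃                              ∎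
        where open ≤-Reasoning

      isMaxMatching-⋃ : IsMaxMatching G full ⋃
      isMaxMatching-⋃ = isMatching-⋃ , λ M isM → halve-≤ (twice-length≤ isM)

    D⇒D-class : ∀ {v} → D G full v → D G (class (part v)) v
    D⇒D-class {v} (_ , M , maxM , v∉M)
      with ClassBound.classBound (part v) (proj₁ maxM) (proj₂ (maximumMatching (class (part v))))
             (v ∷ []) ([] ∷ []) (∈-class⁺ refl ∷ []) (v∉M ∷ [])
    ... | inj₂ (here d) = d
    ... | inj₁ bound = ⊥-elim (<-irrefl refl (begin-strict
        length M + length M                              ≡⟨ twice-length-≡ M ⟩
        Σₚ (λ p → length (endpointsIn p M))
          <⟨ sum-map-mono-< (λ p → endpointsIn-bound p (proj₁ maxM) (proj₂ (fam p))) (∈-parts (part v))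
               (subst (_≤ length (Mₚ (part v)) + length (Mₚ (part v))) (+-comm _ 1) bound) ⟩
        Σₚ (λ p → length (Mₚ p) + length (Mₚ p))         ≡⟨ twice-length-⋃ ⟩
        length ⋃ + length ⋃
          ≤⟨ +-mono-≤ (proj₂ maxM ⋃ isMatching-⋃) (proj₂ maxM ⋃ isMatching-⋃) ⟩
        length M + length M                              ∎))
      where
      fam : ClassMaximumMatchings
      fam p = maximumMatching (class p)
      open Union fam
      open ≤-Reasoning

    D-class⇒D : ∀ {v} → D G (class (part v)) v → D G full v
    D-class⇒D {v} (_ , Mᵥ , maxMᵥ , v∉Mᵥ) =
      refl , ⋃ , isMaxMatching-⋃ ,
      λ c → v∉Mᵥ (subst (λ M → Covered M v) (replaceAt-self (part v) (Mᵥ , maxMᵥ)) (covered-⋃⁻ c))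
      where open Union (replaceAt (part v) (Mᵥ , maxMᵥ))

-- Positions on a cycle

[m%n+k]%n≡[m+k]%n : ∀ m k n .{{_ : NonZero n}} → (m % n + k) % n ≡ (m + k) % n
[m%n+k]%n≡[m+k]%n m k n = begin
  (m % n + k) % n            ≡⟨ %-distribˡ-+ (m % n) k n ⟩
  (m % n % n + k % n) % n    ≡⟨ cong (λ x → (x + k % n) % n) (m%n%n≡m%n m n) ⟩
  (m % n + k % n) % n        ≡⟨ %-distribˡ-+ m k n ⟨
  (m + k) % n                ∎
  where open ≡-Reasoning

-- Adding n ∸ m undoes the offset m.
[m+k]%n-cancelˡ : ∀ m k k′ n .{{_ : NonZero n}} → m ≤ n → (m + k) % n ≡ (m + k′) % n → k % n ≡ k′ % n
[m+k]%n-cancelˡ m k k′ n m≤n eq = trans (sym (undo k)) (trans (cong (λ x → (x + (n ∸ m)) % n) eq) (undo k′))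
  where
  undo : ∀ k → ((m + k) % n + (n ∸ m)) % n ≡ k % n
  undo k = begin
    ((m + k) % n + (n ∸ m)) % n   ≡⟨ [m%n+k]%n≡[m+k]%n (m + k) (n ∸ m) n ⟩
    (m + k + (n ∸ m)) % n         ≡⟨ cong (_% n) (trans (+-assoc m k (n ∸ m)) (cong (m +_) (+-comm k (n ∸ m)))) ⟩
    (m + (n ∸ m + k)) % n         ≡⟨ cong (_% n) (sym (+-assoc m (n ∸ m) k)) ⟩
    (m + (n ∸ m) + k) % n         ≡⟨ cong (λ x → (x + k) % n) (m+[n∸m]≡n m≤n) ⟩
    (n + k) % n                   ≡⟨ cong (_% n) (+-comm n k) ⟩
    (k + n) % n                   ≡⟨ [m+n]%n≡m%n k n ⟩
    k % n                         ∎
    where open ≡-Reasoning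

module _ {m : ℕ} where

  advance : Fin (suc m) → ℕ → Fin (suc m)
  advance a r = (toℕ a + r) mod suc m

  toℕ-advance : ∀ a r → toℕ (advance a r) ≡ (toℕ a + r) % suc m
  toℕ-advance a r = Fin.toℕ-fromℕ< _

  advance-zero : ∀ a → advance a 0 ≡ a
  advance-zero a = Fin.toℕ-injective (begin
    toℕ (advance a 0)      ≡⟨ toℕ-advance a 0 ⟩
    (toℕ a + 0) % suc m    ≡⟨ cong (_% suc m) (+-identityʳ (toℕ a)) ⟩
    toℕ a % suc m          ≡⟨ m<n⇒m%n≡m (Fin.toℕ<n a) ⟩
    toℕ a                  ∎)
    where open ≡-Reasoning

  advance-advance : ∀ a r s → advance (advance a r) s ≡ advance a (r + s)
  advance-advance a r s = Fin.toℕ-injective (begin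
    toℕ (advance (advance a r) s)        ≡⟨ toℕ-advance (advance a r) s ⟩
    (toℕ (advance a r) + s) % suc m      ≡⟨ cong (λ x → (x + s) % suc m) (toℕ-advance a r) ⟩
    ((toℕ a + r) % suc m + s) % suc m    ≡⟨ [m%n+k]%n≡[m+k]%n (toℕ a + r) s (suc m) ⟩
    (toℕ a + r + s) % suc m              ≡⟨ cong (_% suc m) (+-assoc (toℕ a) r s) ⟩
    (toℕ a + (r + s)) % suc m            ≡⟨ toℕ-advance a (r + s) ⟨
    toℕ (advance a (r + s))              ∎)
    where open ≡-Reasoning

  next≡advance1 : ∀ a → next a ≡ advance a 1
  next≡advance1 a = Fin.toℕ-injective (trans (Fin.toℕ-fromℕ< _)
    (trans (cong (_% suc m) (+-comm 1 (toℕ a))) (sym (toℕ-advance a 1))))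

  next-advance : ∀ a r → next (advance a r) ≡ advance a (suc r)
  next-advance a r = trans (next≡advance1 (advance a r))
                       (trans (advance-advance a r 1) (cong (advance a) (+-comm r 1)))

  advance-period : ∀ a → advance a (suc m) ≡ a
  advance-period a = Fin.toℕ-injective (begin
    toℕ (advance a (suc m))      ≡⟨ toℕ-advance a (suc m) ⟩
    (toℕ a + suc m) % suc m      ≡⟨ [m+n]%n≡m%n (toℕ a) (suc m) ⟩
    toℕ a % suc m                ≡⟨ m<n⇒m%n≡m (Fin.toℕ<n a) ⟩
    toℕ a                        ∎)
    where open ≡-Reasoning

  advance-injective : ∀ a {r r′} → r < suc m → r′ < suc m → advance a r ≡ advance a r′ → r ≡ r′
  advance-injective a {r} {r′} r<L r′<L eq = begin
    r                  ≡⟨ m<n⇒m%n≡m r<L ⟨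
    r % suc m          ≡⟨ [m+k]%n-cancelˡ (toℕ a) r r′ (suc m) (≤-trans (n≤1+n _) (Fin.toℕ<n a))
                            (trans (sym (toℕ-advance a r)) (trans (cong toℕ eq) (toℕ-advance a r′))) ⟩
    r′ % suc m         ≡⟨ m<n⇒m%n≡m r′<L ⟩
    r′                 ∎
    where open ≡-Reasoning

  advance-surjective : ∀ a b → Σ ℕ λ r → r < suc m × advance a r ≡ b
  advance-surjective a b = r % suc m , m%n<n r (suc m) , Fin.toℕ-injective (begin
    toℕ (advance a (r % suc m))          ≡⟨ toℕ-advance a (r % suc m) ⟩
    (toℕ a + r % suc m) % suc m          ≡⟨ cong (_% suc m) (+-comm (toℕ a) _) ⟩
    (r % suc m + toℕ a) % suc m          ≡⟨ [m%n+k]%n≡[m+k]%n r (toℕ a) (suc m) ⟩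
    (r + toℕ a) % suc m                  ≡⟨ cong (_% suc m) (+-comm r (toℕ a)) ⟩
    (toℕ a + r) % suc m                  ≡⟨ cong (_% suc m) (m+[n∸m]≡n a≤b+L) ⟩
    (toℕ b + suc m) % suc m              ≡⟨ [m+n]%n≡m%n (toℕ b) (suc m) ⟩
    toℕ b % suc m                        ≡⟨ m<n⇒m%n≡m (Fin.toℕ<n b) ⟩
    toℕ b                                ∎)
    where
    open ≡-Reasoning
    r : ℕ
    r = toℕ b + suc m ∸ toℕ a
    a≤b+L : toℕ a ≤ toℕ b + suc m
    a≤b+L = ≤-trans (≤-trans (n≤1+n _) (Fin.toℕ<n a)) (m≤n+m (suc m) (toℕ b))

  next-injective : ∀ a b → next a ≡ next b → a ≡ b
  next-injective a b eq = Fin.toℕ-injective (begin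
    toℕ a              ≡⟨ m<n⇒m%n≡m (Fin.toℕ<n a) ⟨
    toℕ a % suc m      ≡⟨ [m+k]%n-cancelˡ 1 (toℕ a) (toℕ b) (suc m) (s≤s z≤n)
                            (trans (sym (Fin.toℕ-fromℕ< _)) (trans (cong toℕ eq) (Fin.toℕ-fromℕ< _))) ⟩
    toℕ b % suc m      ≡⟨ m<n⇒m%n≡m (Fin.toℕ<n b) ⟩
    toℕ b              ∎)
    where open ≡-Reasoning

  next≢ : ∀ a → 2 ≤ suc m → next a ≢ a
  next≢ a 2≤L eq with advance-injective a 2≤L (s≤s z≤n) (trans (sym (next≡advance1 a)) (trans eq (sym (advance-zero a))))
  ... | ()

  next²≢ : ∀ a → 3 ≤ suc m → next (next a) ≢ a
  next²≢ a 3≤L eq with advance-injective a 3≤L (s≤s z≤n)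
                         (trans (sym (next-advance a 1)) (trans (cong next (sym (next≡advance1 a))) (trans eq (sym (advance-zero a)))))
  ... | ()

fromℕ-or-inject₁ : ∀ {m} (i : Fin (suc m)) → i ≡ fromℕ m ⊎ Σ (Fin m) λ j → i ≡ inject₁ j
fromℕ-or-inject₁ {zero}  fzero    = inj₁ refl
fromℕ-or-inject₁ {suc m} fzero    = inj₂ (fzero , refl)
fromℕ-or-inject₁ {suc m} (fsuc i) with fromℕ-or-inject₁ i
... | inj₁ refl      = inj₁ refl
... | inj₂ (j , refl) = inj₂ (fsuc j , refl)

next-inject₁ : ∀ {m} (j : Fin m) → next {suc m} (inject₁ j) ≡ fsuc j
next-inject₁ {m} j = Fin.toℕ-injective (trans (Fin.toℕ-fromℕ< _)
  (trans (cong (λ x → suc x % suc m) (Fin.toℕ-inject₁ j)) (m<n⇒m%n≡m (s≤s (Fin.toℕ<n j)))))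

next-fromℕ : ∀ m → next {suc m} (fromℕ m) ≡ fzero
next-fromℕ m = Fin.toℕ-injective (trans (Fin.toℕ-fromℕ< _)
  (trans (cong (λ x → suc x % suc m) (Fin.toℕ-fromℕ m)) (n%n≡0 (suc m))))

iterate-not-even : ∀ s b → iterate not b (s + s) ≡ b
iterate-not-even zero    b = refl
iterate-not-even (suc s) b = begin
  iterate not (not b) (s + suc s)        ≡⟨ cong (iterate not (not b)) (+-suc s s) ⟩
  iterate not (not (not b)) (s + s)      ≡⟨ iterate-not-even s (not (not b)) ⟩
  not (not b)                            ≡⟨ not-involutive b ⟩
  b                                      ∎
  where open ≡-Reasoning

module Cycles {n : ℕ} (G : Graph n) where
  open Paths G

  Reach-snoc : ∀ {X : Fin n → Set} {u w v} → Reach G X u w → Edge G w v → X v → Reach G X u v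
  Reach-snoc here          w~v Xv = step w~v Xv here
  Reach-snoc (step e Xw r) w~v Xv = step e Xw (Reach-snoc r w~v Xv)

  Reach-transport : ∀ {X Y : Fin n → Set} → (∀ {a b} → Y a → Edge G a b → X b → Y b) →
                    ∀ {u v} → Reach G X u v → Y u → Y v
  Reach-transport move here          Yu = Yu
  Reach-transport move (step e Xw r) Yu = Reach-transport move r (move Yu e Xw)

  reachAround : ∀ {L} (f : Fin L → Fin n) → (∀ j → Edge G (f j) (f (next j))) → ∀ a b →
                Reach G (λ w → Σ (Fin L) λ j → f j ≡ w) (f a) (f b)
  reachAround {suc m} f f~ a b with advance-surjective a b
  ... | r , _ , refl = reachAdvance r
    where
    reachAdvance : ∀ r → Reach G (λ w → Σ (Fin (suc m)) λ j → f j ≡ w) (f a) (f (advance a r))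
    reachAdvance zero    = subst (λ j → Reach G _ (f a) (f j)) (sym (advance-zero a)) here
    reachAdvance (suc r) = Reach-snoc (reachAdvance r)
      (subst (λ j → Edge G (f (advance a r)) (f j)) (next-advance a r) (f~ (advance a r))) (_ , refl)

  cycle-connected : ∀ {S} (c : Cycle G S) a b → Reach G (OnCycle c) (vert c a) (vert c b)
  cycle-connected c = reachAround (vert c) (adjc c)

  CycleEdge⇒OnCycle : ∀ {S} (c : Cycle G S) {u v} → CycleEdge c u v → OnCycle c u × OnCycle c v
  CycleEdge⇒OnCycle c (j , inj₁ (refl , refl)) = (j , refl) , (next j , refl)
  CycleEdge⇒OnCycle c (j , inj₂ (refl , refl)) = (next j , refl) , (j , refl)

  closePath : ∀ {S} (P : Path G S) → 2 ≤ plen P → Edge G (pvert P (fromℕ (plen P))) (pvert P fzero) → Cycle G S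
  closePath {S} P 2≤len last~first = record
    { len = suc (plen P) ; len≥3 = s≤s 2≤len ; vert = pvert P ; inj = pinj P ; inS = pinS P ; adjc = adj′ }
    where
    adj′ : ∀ i → Edge G (pvert P i) (pvert P (next i))
    adj′ i with fromℕ-or-inject₁ i
    ... | inj₁ refl      = subst (λ j → Edge G (pvert P (fromℕ (plen P))) (pvert P j)) (sym (next-fromℕ (plen P))) last~first
    ... | inj₂ (j , refl) = subst (λ k → Edge G (pvert P (inject₁ j)) (pvert P k)) (sym (next-inject₁ j)) (padj P j)

  closePath-closingEdge : ∀ {S} (P : Path G S) 2≤len last~first →
    CycleEdge (closePath P 2≤len last~first) (pvert P (fromℕ (plen P))) (pvert P fzero)
  closePath-closingEdge P _ _ = fromℕ (plen P) , inj₁ (refl , cong (pvert P) (next-fromℕ (plen P)))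

  colour-along : ∀ (col : Fin n → Bool) L (f : Fin (suc L) → Fin n) →
                 (∀ i → col (f (inject₁ i)) ≢ col (f (fsuc i))) → col (f (fromℕ L)) ≡ iterate not (col (f fzero)) L
  colour-along col zero    f proper = refl
  colour-along col (suc L) f proper =
    trans (colour-along col L (λ i → f (fsuc i)) (λ i → proper (fsuc i)))
          (cong (λ b → iterate not b L) (¬-not (λ eq → proper fzero (sym eq))))

  evenPath-sameColour : ∀ {S} → (bip : Bipartite G S) → ∀ {u v} → EvenPath S u v → proj₁ bip v ≡ proj₁ bip u
  evenPath-sameColour (col , proper) (P , refl , refl , s , len≡) =
    trans (colour-along col (plen P) (pvert P) (λ i → proper _ _ (pinS P _) (pinS P _) (padj P i)))
          (trans (cong (iterate not _) len≡) (iterate-not-even s _))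

-- Moving the vertex missed by a maximum matching

module FreeVertices {n : ℕ} (G : Graph n) where
  open Matchings G
  open AlternatingPaths G using (isMaxMatching-≡)

  InM? : ∀ (M : List Pair) a b → Dec (InM M a b)
  InM? M a b = ((a , b) ∈? M) ⊎-dec ((b , a) ∈? M)
    where open DecMembership (Product.≡-dec (_≟ᶠ_ {n}) (_≟ᶠ_ {n}))

  record Freed (S : VSet n) (M : List Pair) (Keep : Fin n → Set) (v : Fin n) : Set where
    field
      matching : List Pair
      isMax    : IsMaxMatching G S matching
      v∉       : ¬ Covered matching v
      keeps    : ∀ {a b} → Keep a → InM M a b → InM matching a b

  shift : ∀ {S M x₀ c x} → IsMaxMatching G S M → ¬ Covered M x₀ → x₀ ∈ˢ S → Edge G x₀ c → InM M c x →
          Freed S M (λ a → a ≢ c × a ≢ x) x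
  shift {S} {M} {x₀} {c} {x} maxM x₀∉M x₀∈S x₀~c cx = record
    { matching = (x₀ , c) ∷ M′
    ; isMax = isMaxMatching-≡ maxM isM′ (length-removeEdge M cx)
    ; v∉ = x∉
    ; keeps = λ (a≢c , a≢x) ab → InM-there (InM-removeEdge⁺ M cx ab a≢c a≢x)
    }
    where
    M′ : List Pair
    M′ = removeEdge M cx
    isM′ : IsMatching G S ((x₀ , c) ∷ M′)
    isM′ = isMatching-∷ (isMatching-removeEdge M cx (proj₁ maxM)) x₀~c x₀∈S
             (covered⇒∈S (proj₁ maxM) (InM⇒coveredˡ cx))
             (λ x₀∈M′ → x₀∉M (covered-removeEdge⁻ M cx x₀∈M′))
             (λ c∈M′ → proj₁ (covered-removeEdge-≢ M cx (proj₁ (proj₁ maxM)) c∈M′) refl)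
    x∉ : ¬ Covered ((x₀ , c) ∷ M′) x
    x∉ x∈ with covered-∷⁻ M′ x∈
    ... | inj₁ refl       = x₀∉M (InM⇒coveredʳ cx)
    ... | inj₂ (inj₁ refl) = Edge⇒≢ (InM⇒Edge (proj₁ maxM) cx) refl
    ... | inj₂ (inj₂ x∈M′) = proj₂ (covered-removeEdge-≢ M cx (proj₁ (proj₁ maxM)) x∈M′) refl

  InjectiveUpTo : (ℕ → Fin n) → ℕ → Set
  InjectiveUpTo π k = ∀ {i j} → i ≤ k → j ≤ k → π i ≡ π j → i ≡ j

  AvoidsUpTo : (ℕ → Fin n) → ℕ → Fin n → Set
  AvoidsUpTo π k a = ∀ i → i ≤ k → a ≢ π i

  walkUp : ∀ q (π : ℕ → Fin n) {S M} → IsMaxMatching G S M → ¬ Covered M (π 0) → (∀ m → π m ∈ˢ S) →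
           (∀ m → m < q → Edge G (π (m + m)) (π (suc (m + m)))) →
           (∀ m → m < q → InM M (π (suc (m + m))) (π (suc (suc (m + m))))) →
           InjectiveUpTo π (q + q) → Freed S M (AvoidsUpTo π (q + q)) (π (q + q))
  walkUp zero π {M = M} maxM π₀∉M _ _ _ _ =
    record { matching = M ; isMax = maxM ; v∉ = π₀∉M ; keeps = λ _ ab → ab }
  walkUp (suc q) π {S} {M} maxM π₀∉M π∈S π~ πM π-inj = record
    { matching = F₂.matching
    ; isMax = F₂.isMax
    ; v∉ = subst (λ k → ¬ Covered F₂.matching (π k)) (cong suc (sym (+-suc q q))) F₂.v∉
    ; keeps = λ avoids ab → F₂.keeps (avoids (suc (q + q)) 2q+1≤ , avoids (suc (suc (q + q))) 2q+2≤)
                                       (F₁.keeps (λ i i≤ → avoids i (≤-trans i≤ 2q≤)) ab)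
    }
    where
    2q≤ : q + q ≤ suc q + suc q
    2q≤ = ≤-trans (n≤1+n _) (≤-trans (n≤1+n _) (≤-reflexive (cong suc (sym (+-suc q q)))))
    2q+1≤ : suc (q + q) ≤ suc q + suc q
    2q+1≤ = ≤-trans (n≤1+n _) (≤-reflexive (cong suc (sym (+-suc q q))))
    2q+2≤ : suc (suc (q + q)) ≤ suc q + suc q
    2q+2≤ = ≤-reflexive (cong suc (sym (+-suc q q)))
    F₁ : Freed S M (AvoidsUpTo π (q + q)) (π (q + q))
    F₁ = walkUp q π maxM π₀∉M π∈S (λ m m<q → π~ m (m<n⇒m<1+n m<q)) (λ m m<q → πM m (m<n⇒m<1+n m<q))
                (λ i≤ j≤ → π-inj (≤-trans i≤ 2q≤) (≤-trans j≤ 2q≤))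
    module F₁ = Freed F₁
    F₂ : Freed S F₁.matching (λ a → a ≢ π (suc (q + q)) × a ≢ π (suc (suc (q + q)))) (π (suc (suc (q + q))))
    F₂ = shift F₁.isMax F₁.v∉ (π∈S _) (π~ q ≤-refl)
           (F₁.keeps (λ i i≤ eq → <⇒≢ (s≤s i≤) (sym (π-inj 2q+1≤ (≤-trans i≤ 2q≤) eq))) (πM q ≤-refl))
    module F₂ = Freed F₂

  walkDown : ∀ q (π : ℕ → Fin n) {S M} → IsMaxMatching G S M → ¬ Covered M (π (q + q)) → (∀ m → π m ∈ˢ S) →
             (∀ m → m < q → InM M (π (m + m)) (π (suc (m + m)))) →
             (∀ m → m < q → Edge G (π (suc (m + m))) (π (suc (suc (m + m))))) →
             InjectiveUpTo π (q + q) → Freed S M (AvoidsUpTo π (q + q)) (π 0)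
  walkDown zero π {M = M} maxM π₀∉M _ _ _ _ =
    record { matching = M ; isMax = maxM ; v∉ = π₀∉M ; keeps = λ _ ab → ab }
  walkDown (suc q) π {S} {M} maxM top∉M π∈S πM π~ π-inj = record
    { matching = F₂.matching
    ; isMax = F₂.isMax
    ; v∉ = F₂.v∉
    ; keeps = λ avoids ab → F₂.keeps (λ i i≤ → avoids i (≤-trans i≤ 2q≤))
                                       (F₁.keeps (avoids (suc (q + q)) 2q+1≤ , avoids (q + q) 2q≤) ab)
    }
    where
    2q≤ : q + q ≤ suc q + suc q
    2q≤ = ≤-trans (n≤1+n _) (≤-trans (n≤1+n _) (≤-reflexive (cong suc (sym (+-suc q q)))))
    2q+1≤ : suc (q + q) ≤ suc q + suc q
    2q+1≤ = ≤-trans (n≤1+n _) (≤-reflexive (cong suc (sym (+-suc q q))))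
    F₁ : Freed S M (λ a → a ≢ π (suc (q + q)) × a ≢ π (q + q)) (π (q + q))
    F₁ = shift maxM (subst (λ k → ¬ Covered M (π k)) (cong suc (+-suc q q)) top∉M) (π∈S _)
               (Edge-sym (π~ q ≤-refl)) (InM-sym (πM q ≤-refl))
    module F₁ = Freed F₁
    below : ∀ m → m < q → π (m + m) ≢ π (suc (q + q)) × π (m + m) ≢ π (q + q)
    below m m<q = (λ eq → <⇒≢ (s≤s 2m≤2q) (π-inj (≤-trans 2m≤2q 2q≤) 2q+1≤ eq))
                , (λ eq → <⇒≢ 2m<2q (π-inj (≤-trans 2m≤2q 2q≤) 2q≤ eq))
      where
      2m<2q : m + m < q + q
      2m<2q = +-mono-< m<q m<q
      2m≤2q : m + m ≤ q + q
      2m≤2q = <⇒≤ 2m<2q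
    F₂ : Freed S F₁.matching (AvoidsUpTo π (q + q)) (π 0)
    F₂ = walkDown q π F₁.isMax F₁.v∉ π∈S (λ m m<q → F₁.keeps (below m m<q) (πM m (m<n⇒m<1+n m<q)))
                  (λ m m<q → π~ m (m<n⇒m<1+n m<q)) (λ i≤ j≤ → π-inj (≤-trans i≤ 2q≤) (≤-trans j≤ 2q≤))
    module F₂ = Freed F₂

-- Stems and blossoms

clamp : ∀ L → ℕ → Fin (suc L)
clamp L m with m ≤? L
... | yes m≤L = fromℕ< (s≤s m≤L)
... | no  _   = fromℕ L

toℕ-clamp : ∀ {L m} → m ≤ L → toℕ (clamp L m) ≡ m
toℕ-clamp {L} {m} m≤L with m ≤? L
... | yes _   = Fin.toℕ-fromℕ< _
... | no  m≰L = ⊥-elim (m≰L m≤L)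

clamp-toℕ : ∀ {L} (i : Fin (suc L)) → clamp L (toℕ i) ≡ i
clamp-toℕ i = Fin.toℕ-injective (toℕ-clamp (≤-pred (Fin.toℕ<n i)))

module Stems {n : ℕ} (G : Graph n) where
  open Matchings G
  open FreeVertices G

  along : ∀ {S} → Path G S → ℕ → Fin n
  along P m = pvert P (clamp (plen P) m)

  along-≡ : ∀ {S} (P : Path G S) (i : Fin (suc (plen P))) {m} → toℕ i ≡ m → along P m ≡ pvert P i
  along-≡ P i refl = cong (pvert P) (clamp-toℕ i)

  along-stepˡ : ∀ {S} (P : Path G S) {m} (m< : m < plen P) → along P m ≡ pvert P (inject₁ (fromℕ< m<))
  along-stepˡ P m< = along-≡ P (inject₁ (fromℕ< m<)) (trans (Fin.toℕ-inject₁ _) (Fin.toℕ-fromℕ< m<))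

  along-stepʳ : ∀ {S} (P : Path G S) {m} (m< : m < plen P) → along P (suc m) ≡ pvert P (fsuc (fromℕ< m<))
  along-stepʳ P m< = along-≡ P (fsuc (fromℕ< m<)) (cong suc (Fin.toℕ-fromℕ< m<))

  along-edge : ∀ {S} (P : Path G S) {m} → m < plen P → Edge G (along P m) (along P (suc m))
  along-edge P m< = subst₂ (Edge G) (sym (along-stepˡ P m<)) (sym (along-stepʳ P m<)) (padj P (fromℕ< m<))

  along-injective : ∀ {S} (P : Path G S) → InjectiveUpTo (along P) (plen P)
  along-injective P i≤ j≤ eq = trans (sym (toℕ-clamp i≤)) (trans (cong toℕ (pinj P _ _ eq)) (toℕ-clamp j≤))

  module _ {S M} (P : Path G S) (alt : Alternating M P) where

    MatchedStep : ℕ → Set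
    MatchedStep m = InM M (along P m) (along P (suc m))

    alternation : ∀ {m} (m+1< : suc m < plen P) → PathEdgeInM M P (fromℕ< m+1<) ⇔ (¬ PathEdgeInM M P (fromℕ< (<⇒≤ m+1<)))
    alternation m+1< = alt (fromℕ< (<⇒≤ m+1<)) (fromℕ< m+1<)
                           (trans (Fin.toℕ-fromℕ< m+1<) (cong suc (sym (Fin.toℕ-fromℕ< (<⇒≤ m+1<)))))

    toPathEdge : ∀ {m} (m< : m < plen P) → MatchedStep m → PathEdgeInM M P (fromℕ< m<)
    toPathEdge m< = subst₂ (InM M) (along-stepˡ P m<) (along-stepʳ P m<)

    fromPathEdge : ∀ {m} (m< : m < plen P) → PathEdgeInM M P (fromℕ< m<) → MatchedStep m
    fromPathEdge m< = subst₂ (InM M) (sym (along-stepˡ P m<)) (sym (along-stepʳ P m<))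

    unmatchedBefore : ∀ {m} → suc m < plen P → MatchedStep (suc m) → ¬ MatchedStep m
    unmatchedBefore m+1< e′ e = Equivalence.to (alternation m+1<) (toPathEdge m+1< e′) (toPathEdge (<⇒≤ m+1<) e)

    matchedBefore : ∀ {m} → suc m < plen P → ¬ MatchedStep (suc m) → MatchedStep m
    matchedBefore {m} m+1< ¬e′ with InM? M (along P m) (along P (suc m))
    ... | yes e = e
    ... | no ¬e = ⊥-elim (¬e′ (fromPathEdge m+1<
                    (Equivalence.from (alternation m+1<) (λ e → ¬e (fromPathEdge (<⇒≤ m+1<) e)))))

    -- The last step ends at a vertex missed by M, so it is unmatched; alternation then matches every even step.
    evenStepsMatched : ∀ s → plen P ≡ s + s → ¬ Covered M (along P (s + s)) → ∀ m → m < s → MatchedStep (m + m)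
    evenStepsMatched s len≡ last∉M m m<s = matchedAt (s ∸ suc m) m (m+[n∸m]≡n m<s)
      where
      len-split : ∀ k d → suc (k + d) ≡ s → plen P ≡ suc (suc (k + k + (d + d)))
      len-split k d eq = trans len≡ (trans (cong (λ x → x + x) (sym eq)) (twice k d))
        where
        twice : ∀ k d → suc (k + d) + suc (k + d) ≡ suc (suc (k + k + (d + d)))
        twice = solve 2 (λ k d → (con 1 :+ (k :+ d)) :+ (con 1 :+ (k :+ d)) := con 2 :+ (k :+ k :+ (d :+ d))) refl
      2k+1< : ∀ d k → suc (k + d) ≡ s → suc (k + k) < plen P
      2k+1< d k eq = subst (suc (suc (k + k)) ≤_) (sym (len-split k d eq)) (s≤s (s≤s (m≤m+n (k + k) (d + d))))

      matchedAt   : ∀ d k → suc (k + d) ≡ s → MatchedStep (k + k)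
      unmatchedAt : ∀ d k → suc (k + d) ≡ s → ¬ MatchedStep (suc (k + k))

      matchedAt d k eq = matchedBefore (2k+1< d k eq) (unmatchedAt d k eq)

      unmatchedAt zero k eq e = last∉M (subst (λ x → Covered M (along P x)) end≡ (InM⇒coveredʳ e))
        where
        end≡ : suc (suc (k + k)) ≡ s + s
        end≡ = trans (cong (λ x → suc (suc x)) (sym (+-identityʳ (k + k)))) (sym (trans (sym len≡) (len-split k 0 eq)))
      unmatchedAt (suc d) k eq =
        unmatchedBefore 2k+2< (subst MatchedStep (cong suc (+-suc k k)) (matchedAt d (suc k) (trans (cong suc (sym (+-suc k d))) eq)))
        where
        2k+2< : suc (suc (k + k)) < plen P
        2k+2< = subst (suc (suc (suc (k + k))) ≤_) (sym (len-split k (suc d) eq)) (s≤s (s≤s (m<m+n (k + k) (s≤s z≤n))))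

  stemFreesBase : ∀ {S M} → IsMaxMatching G S M → (P : Path G S) → ∀ s → plen P ≡ s + s → Alternating M P →
                  ¬ Covered M (pvert P (fromℕ (plen P))) → Freed S M (λ a → ∀ k → pvert P k ≢ a) (pvert P fzero)
  stemFreesBase {M = M} maxM P s len≡ alt last∉M = record
    { matching = F.matching
    ; isMax = F.isMax
    ; v∉ = subst (λ v → ¬ Covered F.matching v) (along-≡ P fzero refl) F.v∉
    ; keeps = λ avoid → F.keeps (λ i _ eq → avoid (clamp (plen P) i) (sym eq))
    }
    where
    last∉M′ : ¬ Covered M (along P (s + s))
    last∉M′ = subst (λ v → ¬ Covered M v) (sym (along-≡ P (fromℕ (plen P)) (trans (Fin.toℕ-fromℕ _) len≡))) last∉M
    odd< : ∀ m → m < s → suc (m + m) < plen P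
    odd< m m<s = subst (suc (suc (m + m)) ≤_) (sym len≡) (subst (_≤ s + s) (cong suc (+-suc m m)) (+-mono-≤ m<s m<s))
    F : Freed _ M (AvoidsUpTo (along P) (s + s)) (along P 0)
    F = walkDown s (along P) maxM last∉M′ (λ m → pinS P _) (evenStepsMatched P alt s len≡ last∉M′)
          (λ m m<s → along-edge P (odd< m m<s)) (subst (InjectiveUpTo (along P)) len≡ (along-injective P))
    module F = Freed F

evenOrOdd : ∀ r → Σ ℕ λ q → r ≡ q + q ⊎ r ≡ suc (q + q)
evenOrOdd zero = 0 , inj₁ refl
evenOrOdd (suc r) with evenOrOdd r
... | q , inj₁ refl = q , inj₂ refl
... | q , inj₂ refl = suc q , inj₁ (cong suc (sym (+-suc q q)))

module Blossoms {n : ℕ} (G : Graph n) where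
  open Matchings G
  open FreeVertices G

  module Blossom {S M} (maxM : IsMaxMatching G S M) (t : ℕ) (f : Fin (suc (t + t)) → Fin n)
                 (f-injective : ∀ i j → f i ≡ f j → i ≡ j) (f∈S : ∀ i → f i ∈ˢ S)
                 (f~ : ∀ i → Edge G (f i) (f (next i))) (3≤L : 3 ≤ suc (t + t))
                 (idx : List (Fin (suc (t + t)))) (idx-unique : Unique idx) (|idx|≡t : length idx ≡ t)
                 (idx⇔ : ∀ i → (i ∈ idx) ⇔ InM M (f i) (f (next i)))
                 (β : Fin (suc (t + t)))
                 (base∉ : ∀ i → InM M (f i) (f (next i)) → f i ≢ f β × f (next i) ≢ f β) where

    L : ℕ
    L = suc (t + t)

    MatchedAt : Fin L → Set
    MatchedAt i = InM M (f i) (f (next i))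

    ends : List (Fin L) → List (Fin L)
    ends []       = []
    ends (i ∷ is) = i ∷ next i ∷ ends is

    ∈-ends⁻ : ∀ is {w} → w ∈ ends is → Σ (Fin L) λ i → i ∈ is × (w ≡ i ⊎ w ≡ next i)
    ∈-ends⁻ (i ∷ is) (here refl)         = i , here refl , inj₁ refl
    ∈-ends⁻ (i ∷ is) (there (here refl)) = i , here refl , inj₂ refl
    ∈-ends⁻ (i ∷ is) (there (there w∈))  = let j , j∈ , w≡ = ∈-ends⁻ is w∈ in j , there j∈ , w≡

    length-ends : ∀ is → length (ends is) ≡ length is + length is
    length-ends []       = refl
    length-ends (_ ∷ is) = cong suc (trans (cong suc (length-ends is)) (sym (+-suc _ _)))

    partner≡ : ∀ {i j} → MatchedAt i → MatchedAt j → i ≡ next j → j ≡ next i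
    partner≡ {i} {j} mi mj refl = f-injective _ _ (InM-functional (proj₁ (proj₁ maxM)) (InM-sym mj) mi)

    disjointEnds : ∀ {i j} → MatchedAt i → MatchedAt j → i ≢ j →
                   ∀ {w} → w ≡ j ⊎ w ≡ next j → i ≢ w × next i ≢ w
    disjointEnds {i} {j} mi mj i≢j (inj₁ refl) =
      i≢j , λ next-i≡j → next²≢ i 3≤L (trans (cong next next-i≡j) (sym (partner≡ mj mi (sym next-i≡j))))
    disjointEnds {i} {j} mi mj i≢j (inj₂ refl) =
      (λ i≡next-j → next²≢ i 3≤L (trans (cong next (sym (partner≡ mi mj i≡next-j))) (sym i≡next-j))) ,
      (λ eq → i≢j (next-injective i j eq))

    Unique-ends : ∀ is → Unique is → All MatchedAt is → Unique (ends is)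
    Unique-ends []       _          _          = []
    Unique-ends (i ∷ is) (i∉is ∷ u) (mi ∷ ms) =
      ((λ eq → next≢ i (≤-trans (n≤1+n 2) 3≤L) (sym eq)) ∷ All.tabulate (λ w∈ → proj₁ (avoid w∈)))
      ∷ All.tabulate (λ w∈ → proj₂ (avoid w∈)) ∷ Unique-ends is u ms
      where
      avoid : ∀ {w} → w ∈ ends is → i ≢ w × next i ≢ w
      avoid w∈ = let j , j∈ , w≡ = ∈-ends⁻ is w∈ in disjointEnds mi (All.lookup ms j∈) (All.lookup i∉is j∈) w≡

    matchedAt-idx : All MatchedAt idx
    matchedAt-idx = All.tabulate (λ i∈ → Equivalence.to (idx⇔ _) i∈)

    β∉ends : ∀ {w} → w ∈ ends idx → β ≢ w
    β∉ends w∈ β≡w with ∈-ends⁻ idx w∈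
    ... | j , j∈ , inj₁ w≡j = proj₁ (base∉ j (All.lookup matchedAt-idx j∈)) (cong f (sym (trans β≡w w≡j)))
    ... | j , j∈ , inj₂ w≡j = proj₂ (base∉ j (All.lookup matchedAt-idx j∈)) (cong f (sym (trans β≡w w≡j)))

    -- The t matched edges have 2t distinct ends, none of them the base, so they cover all other L - 1 positions.
    coveredByBlossom : ∀ r → 1 ≤ r → r ≤ t + t →
                       Σ (Fin L) λ i → i ∈ idx × (i ≡ advance β r ⊎ next i ≡ advance β r)
    coveredByBlossom r 1≤r r≤2t with any? (λ i → (i ≟ᶠ advance β r) ⊎-dec (next i ≟ᶠ advance β r)) idx
    ... | yes found = find found
    ... | no  none  = ⊥-elim (<-irrefl refl (subst₂ _≤_ |big|≡ (length-tabulate (λ i → i))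
                       (Unique-⊆⇒length-≤ big-unique (λ {w} _ → ∈-allFin w))))
      where
      big : List (Fin L)
      big = β ∷ advance β r ∷ ends idx
      β≢r : β ≢ advance β r
      β≢r eq with subst (1 ≤_) (sym (advance-injective β (s≤s z≤n) (s≤s r≤2t) (trans (advance-zero β) eq))) 1≤r
      ... | ()
      r∉ends : ∀ {w} → w ∈ ends idx → advance β r ≢ w
      r∉ends w∈ eq with ∈-ends⁻ idx w∈
      ... | j , j∈ , inj₁ w≡j = none (Any.map (λ { refl → inj₁ (sym (trans eq w≡j)) }) j∈)
      ... | j , j∈ , inj₂ w≡j = none (Any.map (λ { refl → inj₂ (sym (trans eq w≡j)) }) j∈)
      big-unique : Unique big
      big-unique = (β≢r ∷ All.tabulate β∉ends) ∷ All.tabulate r∉ends ∷ Unique-ends idx idx-unique matchedAt-idx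
      |big|≡ : length big ≡ suc L
      |big|≡ = cong (λ x → suc (suc x)) (trans (length-ends idx) (cong (λ x → x + x) |idx|≡t))

    c : ℕ → Fin n
    c r = f (advance β r)

    advance-edge : ∀ b r → Edge G (f (advance b r)) (f (advance b (suc r)))
    advance-edge b r = subst (λ k → Edge G (f (advance b r)) (f k)) (next-advance b r) (f~ (advance b r))

    c-injective : ∀ {r r′} → r < L → r′ < L → c r ≡ c r′ → r ≡ r′
    c-injective r< r′< eq = advance-injective β r< r′< (f-injective _ _ eq)

    2j+1≤2t : ∀ {j} → j < t → suc (j + j) ≤ t + t
    2j+1≤2t j<t = +-mono-≤ j<t (<⇒≤ j<t)

    blossomPattern    : ∀ j → j < t → MatchedAt (advance β (suc (j + j)))
    unmatchedEvenStep : ∀ j → j < t → ¬ MatchedAt (advance β (j + j))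

    blossomPattern j j<t with coveredByBlossom (suc (j + j)) (s≤s z≤n) (2j+1≤2t j<t)
    ... | i , i∈ , inj₁ refl   = Equivalence.to (idx⇔ _) i∈
    ... | i , i∈ , inj₂ next-i≡ =
      ⊥-elim (unmatchedEvenStep j j<t (subst MatchedAt i≡ (Equivalence.to (idx⇔ _) i∈)))
      where
      i≡ : i ≡ advance β (j + j)
      i≡ = next-injective _ _ (trans next-i≡ (sym (next-advance β (j + j))))

    unmatchedEvenStep zero    _   m₀ = proj₁ (base∉ _ m₀) (cong f (advance-zero β))
    unmatchedEvenStep (suc j) j<t matched = <-irrefl 2j+1≡2j+3 (s≤s (n≤1+n _))
      where
      j<t′ : j < t
      j<t′ = <-trans (n<1+n j) j<t
      k : ℕ
      k = suc (suc (j + j))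
      k-matched : InM M (f (advance β k)) (f (advance β (suc k)))
      k-matched = subst (λ i → InM M (f (advance β i)) (f (advance β (suc i)))) (cong suc (+-suc j j))
                    (subst (λ y → InM M (f (advance β (suc j + suc j))) (f y)) (next-advance β _) matched)
      previous : InM M (f (advance β k)) (f (advance β (suc (j + j))))
      previous = InM-sym (subst (λ y → InM M (f (advance β (suc (j + j)))) (f y)) (next-advance β _) (blossomPattern j j<t′))
      2j+3≤2t : suc k ≤ t + t
      2j+3≤2t = subst (_≤ t + t) (cong (λ x → suc (suc x)) (+-suc j j)) (2j+1≤2t j<t)
      2j+1≡2j+3 : suc (j + j) ≡ suc k
      2j+1≡2j+3 = c-injective (s≤s (2j+1≤2t j<t′)) (s≤s 2j+3≤2t)
                    (InM-functional (proj₁ (proj₁ maxM)) previous k-matched)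

    module _ {M₀} (maxM₀ : IsMaxMatching G S M₀) (β∉M₀ : ¬ Covered M₀ (f β))
             (agree : ∀ i → MatchedAt i → InM M₀ (f i) (f (next i))) where

      matched₀ : ∀ j → j < t → InM M₀ (c (suc (j + j))) (c (suc (suc (j + j))))
      matched₀ j j<t = subst (λ y → InM M₀ (c (suc (j + j))) (f y)) (next-advance β _) (agree _ (blossomPattern j j<t))

      evenPosition∈D : ∀ q → q + q < L → D G S (c (q + q))
      evenPosition∈D q 2q<L = f∈S _ , F.matching , F.isMax , F.v∉
        where
        q≤t : q ≤ t
        q≤t = halve-≤ (≤-pred 2q<L)
        F : Freed S M₀ (AvoidsUpTo c (q + q)) (c (q + q))
        F = walkUp q c maxM₀ (subst (λ b → ¬ Covered M₀ (f b)) (sym (advance-zero β)) β∉M₀) (λ _ → f∈S _)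
              (λ m _ → advance-edge β (m + m)) (λ m m<q → matched₀ m (≤-trans m<q q≤t))
              (λ i≤ j≤ → c-injective (≤-<-trans i≤ 2q<L) (≤-<-trans j≤ 2q<L))
        module F = Freed F

      -- Odd positions are reached the other way round: walk from position 2q+1 forward to the base at position L.
      oddPosition∈D : ∀ q → suc (q + q) < L → D G S (c (suc (q + q)))
      oddPosition∈D q 2q+1<L = f∈S _ , F.matching , F.isMax , subst (λ v → ¬ Covered F.matching v) π₀≡ F.v∉
        where
        a : ℕ
        a = suc (q + q)
        π : ℕ → Fin n
        π m = f (advance (advance β a) m)
        π≡c : ∀ m → π m ≡ c (a + m)
        π≡c m = cong f (advance-advance β a m)
        π₀≡ : π 0 ≡ c a
        π₀≡ = cong f (advance-zero (advance β a))
        q<t : q < t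
        q<t = ≰⇒> (λ t≤q → <⇒≱ (≤-pred 2q+1<L) (+-mono-≤ t≤q t≤q))
        w : ℕ
        w = t ∸ q
        q+w≡t : q + w ≡ t
        q+w≡t = m+[n∸m]≡n (<⇒≤ q<t)
        end≡ : a + (w + w) ≡ L
        end≡ = trans (regroup q w) (cong (λ x → suc (x + x)) q+w≡t)
          where
          regroup : ∀ q w → suc (q + q) + (w + w) ≡ suc ((q + w) + (q + w))
          regroup = solve 2 (λ q w → (con 1 :+ (q :+ q)) :+ (w :+ w) := con 1 :+ ((q :+ w) :+ (q :+ w))) refl
        π-end : π (w + w) ≡ f β
        π-end = trans (π≡c (w + w)) (trans (cong (λ r → f (advance β r)) end≡) (cong f (advance-period β)))
        shape : ∀ m → suc ((q + m) + (q + m)) ≡ a + (m + m) × suc (suc ((q + m) + (q + m))) ≡ a + suc (m + m)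
        shape m = shape₁ q m , shape₂ q m
          where
          shape₁ : ∀ q m → suc ((q + m) + (q + m)) ≡ suc (q + q) + (m + m)
          shape₁ = solve 2 (λ q m → con 1 :+ ((q :+ m) :+ (q :+ m)) := (con 1 :+ (q :+ q)) :+ (m :+ m)) refl
          shape₂ : ∀ q m → suc (suc ((q + m) + (q + m))) ≡ suc (q + q) + suc (m + m)
          shape₂ = solve 2 (λ q m → con 2 :+ ((q :+ m) :+ (q :+ m)) := (con 1 :+ (q :+ q)) :+ (con 1 :+ (m :+ m))) refl
        matched : ∀ m → m < w → InM M₀ (π (m + m)) (π (suc (m + m)))
        matched m m<w = subst₂ (InM M₀) (trans (cong c (proj₁ (shape m))) (sym (π≡c _)))
                                         (trans (cong c (proj₂ (shape m))) (sym (π≡c _)))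
                          (matched₀ (q + m) (subst (q + m <_) q+w≡t (+-monoʳ-< q m<w)))
        w+w<L : w + w < L
        w+w<L = subst (suc (w + w) ≤_) end≡ (s≤s (m≤n+m (w + w) (q + q)))
        F : Freed S M₀ (AvoidsUpTo π (w + w)) (π 0)
        F = walkDown w π maxM₀ (subst (λ v → ¬ Covered M₀ v) (sym π-end) β∉M₀) (λ _ → f∈S _) matched
              (λ m _ → advance-edge (advance β a) (suc (m + m)))
              (λ i≤ j≤ eq → advance-injective (advance β a) (≤-<-trans i≤ w+w<L) (≤-<-trans j≤ w+w<L)
                              (f-injective _ _ eq))
        module F = Freed F

      blossom⊆D : ∀ i → D G S (f i)
      blossom⊆D i with advance-surjective β i
      ... | r , r<L , refl with evenOrOdd r
      ...   | q , inj₁ refl = evenPosition∈D q r<L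
      ...   | q , inj₂ refl = oddPosition∈D q r<L

-- BAB-graphs

module Flowers {n : ℕ} (G : Graph n) where
  open Matchings G
  open FreeVertices G
  open Stems G
  open Blossoms G

  blossomVertices∈D : ∀ {S M M₀} L (f : Fin L → Fin n) → (∀ i j → f i ≡ f j → i ≡ j) → (∀ i → f i ∈ˢ S) →
              (∀ i → Edge G (f i) (f (next i))) → 3 ≤ L → ∀ t → L ≡ suc (t + t) →
              (idx : List (Fin L)) → Unique idx → length idx ≡ t → (∀ i → (i ∈ idx) ⇔ InM M (f i) (f (next i))) →
              ∀ β → (∀ i → InM M (f i) (f (next i)) → f i ≢ f β × f (next i) ≢ f β) →
              IsMaxMatching G S M → IsMaxMatching G S M₀ → ¬ Covered M₀ (f β) →
              (∀ i → InM M (f i) (f (next i)) → InM M₀ (f i) (f (next i))) → ∀ j → D G S (f j)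
  blossomVertices∈D _ f f-inj f∈S f~ 3≤L t refl idx uidx |idx| idx⇔ β base∉ maxM maxM₀ β∉M₀ agree =
    Blossom.blossom⊆D maxM t f f-inj f∈S f~ 3≤L idx uidx |idx| idx⇔ β base∉ maxM₀ β∉M₀ agree

  -- The stem lets us free the base while keeping the blossom's matched edges,
  -- since the stem meets the blossom only in the base.
  flower⇒D : ∀ {S} (c : Cycle G S) {v} → InSomeFlower G S c v → ∀ j → D G S (vert c j)
  flower⇒D c (M , maxM , (t , len≡ , idx , uidx , |idx| , idx⇔) , b , ((β , β≡b) , base∉) , P ,
              (P₀≡b , (s , plen≡) , alt , last∉M , stem∩cycle) , _) =
    blossomVertices∈D (len c) (vert c) (inj c) (inS c) (adjc c) (len≥3 c) t len≡ idx uidx |idx| idx⇔ β base∉β maxM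
              F.isMax (subst (λ v → ¬ Covered F.matching v) (trans P₀≡b (sym β≡b)) F.v∉) agree
    where
    F : Freed _ M (λ a → ∀ k → pvert P k ≢ a) (pvert P fzero)
    F = stemFreesBase maxM P s plen≡ alt last∉M
    module F = Freed F
    base∉β : ∀ i → InM M (vert c i) (vert c (next i)) → vert c i ≢ vert c β × vert c (next i) ≢ vert c β
    base∉β i m = let a , b′ = base∉ i m in (λ eq → a (trans eq β≡b)) , (λ eq → b′ (trans eq β≡b))
    agree : ∀ i → InM M (vert c i) (vert c (next i)) → InM F.matching (vert c i) (vert c (next i))
    agree i m = F.keeps (λ k Pk≡ → proj₁ (base∉ i m) (trans (sym Pk≡) (stem∩cycle k (i , sym Pk≡)))) m

module BABGraphs {n k : ℕ} (G : Graph n) (bab : BAB G k) where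
  open Matchings G
  open Paths G
  open AlternatingPaths G
  open Cycles G
  open Flowers G
  open Partition G (Maybe.≡-dec _≟ᶠ_) (part bab)

  parts : List (Maybe (Fin k))
  parts = nothing ∷ map just (allFin k)

  parts-unique : Unique parts
  parts-unique = All.tabulate nothing∉ ∷ UniqueP.map⁺ Maybe.just-injective (UniqueP.allFin⁺ k)
    where
    nothing∉ : ∀ {p} → p ∈ map just (allFin k) → nothing ≢ p
    nothing∉ p∈ refl with ∈-map⁻ just p∈
    ... | _ , _ , ()

  ∈-parts : ∀ p → p ∈ parts
  ∈-parts nothing  = here refl
  ∈-parts (just i) = there (∈-map⁺ just (∈-allFin i))

  CrossOK⇒¬D : ∀ p {u} → CrossOK G (part bab) p u → ¬ D G (class p) u
  CrossOK⇒¬D nothing  (inj₁ inA) = proj₁ (proj₂ inA)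
  CrossOK⇒¬D nothing  (inj₂ inC) = proj₁ (proj₂ inC)
  CrossOK⇒¬D (just _) inA        = proj₁ (proj₂ inA)

  crossing : ∀ {u v} → Edge G u v → part bab u ≢ part bab v → ¬ D G (class (part bab u)) u
  crossing {u} {v} u~v u≁v = CrossOK⇒¬D (part bab u) (cross bab u v u~v u≁v)

  D⇒D-piece : ∀ {v} → D G full v → D G (class (part bab v)) v
  D⇒D-piece = D⇒D-class parts parts-unique ∈-parts crossing

  D-piece⇒D : ∀ {v} → D G (class (part bab v)) v → D G full v
  D-piece⇒D = D-class⇒D parts parts-unique ∈-parts crossing

  onCycle⇒part : ∀ i {v} → OnCycle (cyc bab i) v → part bab v ≡ just i
  onCycle⇒part i (j , refl) = ∈-class⁻ (inS (cyc bab i) j)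

  cycle⊆D : ∀ i {v} → OnCycle (cyc bab i) v → D G full v
  cycle⊆D i (j , refl) = D-piece⇒D (subst (λ p → D G (class p) (vert c j)) (sym (onCycle⇒part i (j , refl)))
                                         (flower⇒D c (flowers bab i (vert c j) (inS c j)) j))
    where
    c : Cycle G (class (just i))
    c = cyc bab i

  -- An even path and an edge between its ends form an odd cycle: impossible in B, and the unique odd cycle C_i in G_i.
  closingEdge⇒onCycle : ∀ p {u v} → EvenPath (class p) u v → Edge G u v →
                        Σ (Fin k) λ i → OnCycle (cyc bab i) u × OnCycle (cyc bab i) v
  closingEdge⇒onCycle p (P , refl , refl , zero , len≡) u~v =
    ⊥-elim (Edge⇒≢ u~v (cong (pvert P) (Fin.toℕ-injective (sym (trans (Fin.toℕ-fromℕ _) len≡)))))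
  closingEdge⇒onCycle nothing (P , refl , refl , suc s , len≡) u~v =
    ⊥-elim (proper _ _ (pinS P _) (pinS P _) u~v (sym (evenPath-sameColour (B-bip bab) (P , refl , refl , suc s , len≡))))
    where
    proper : ∀ u v → u ∈ˢ class nothing → v ∈ˢ class nothing → Edge G u v →
             proj₁ (B-bip bab) u ≢ proj₁ (B-bip bab) v
    proper = proj₂ (B-bip bab)
  closingEdge⇒onCycle (just i) (P , refl , refl , suc s , len≡) u~v =
    i , proj₂ onCᵢ , proj₁ onCᵢ
    where
    2≤len : 2 ≤ plen P
    2≤len = subst (2 ≤_) (sym len≡) (s≤s (subst (1 ≤_) (sym (+-suc s s)) (s≤s z≤n)))
    C′ : Cycle G (class (just i))
    C′ = closePath P 2≤len (Edge-sym u~v)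
    onCᵢ : OnCycle (cyc bab i) (pvert P (fromℕ (plen P))) × OnCycle (cyc bab i) (pvert P fzero)
    onCᵢ = CycleEdge⇒OnCycle (cyc bab i)
             (Equivalence.from (proj₂ (cyc-uniq bab i) C′ (suc s , cong suc len≡) _ _)
                (closePath-closingEdge P 2≤len (Edge-sym u~v)))

  D-neighbours-onCycle : ∀ {u v} → D G full u → D G full v → Edge G u v →
                         Σ (Fin k) λ i → OnCycle (cyc bab i) u × OnCycle (cyc bab i) v
  D-neighbours-onCycle {u} {v} du dv u~v with Maybe.≡-dec _≟ᶠ_ (part bab u) (part bab v)
  ... | no  u≁v = ⊥-elim (crossing u~v u≁v (D⇒D-piece du))
  ... | yes u∼v = closingEdge⇒onCycle (part bab u)
                    (evenPathBetween (D⇒D-piece du) (subst (λ p → D G (class p) v) (sym u∼v) (D⇒D-piece dv)) u~v) u~v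

  cycle-closed : ∀ i {u v} → OnCycle (cyc bab i) u → D G full v → Edge G u v → OnCycle (cyc bab i) v
  cycle-closed i onCᵢ dv u~v with D-neighbours-onCycle (cycle⊆D i onCᵢ) dv u~v
  ... | j , onCⱼ , v∈Cⱼ = subst (λ j → OnCycle (cyc bab j) _) j≡i v∈Cⱼ
    where
    j≡i : j ≡ i
    j≡i = Maybe.just-injective (trans (sym (onCycle⇒part j onCⱼ)) (onCycle⇒part i onCᵢ))

  cycle-isComponent : ∀ i → IsComponent G (D G full) (OnCycle (cyc bab i))
  cycle-isComponent i =
    (λ _ → cycle⊆D i) ,
    (vert c j₀ , j₀ , refl) ,
    (λ { _ _ (a , refl) (b , refl) → cycle-connected c a b }) ,
    (λ _ _ → cycle-closed i)
    where
    c : Cycle G (class (just i))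
    c = cyc bab i
    j₀ : Fin (len c)
    j₀ = fromℕ< (≤-trans (s≤s z≤n) (len≥3 c))

  onSomeCycle? : ∀ x → Dec (Σ (Fin k) λ i → OnCycle (cyc bab i) x)
  onSomeCycle? x = Fin.any? (λ i → Fin.any? (λ j → vert (cyc bab i) j ≟ᶠ x))

  other-components-singletons : ∀ (X : Fin n → Set) → IsComponent G (D G full) X →
    (∀ i → ¬ (∀ v → X v ⇔ OnCycle (cyc bab i) v)) → Σ (Fin n) λ v → ∀ w → X w ⇔ (w ≡ v)
  other-components-singletons X (X⊆D , (x , Xx) , connected , closed) X≠Cᵢ with onSomeCycle? x
  ... | yes (i , x∈Cᵢ) = ⊥-elim (X≠Cᵢ i λ v → mk⇔
          (λ Xv → Reach-transport (λ onC e Xb → cycle-closed i onC (X⊆D _ Xb) e) (connected x v Xx Xv) x∈Cᵢ)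
          (λ v∈Cᵢ → Reach-transport (λ Xa e onC → closed _ _ Xa (cycle⊆D i onC) e) (reach x∈Cᵢ v∈Cᵢ) Xx))
    where
    reach : ∀ {v} → OnCycle (cyc bab i) x → OnCycle (cyc bab i) v → Reach G (OnCycle (cyc bab i)) x v
    reach (a , refl) (b , refl) = cycle-connected (cyc bab i) a b
  ... | no  x∉C = x , λ w → mk⇔ (λ Xw → isolated (connected x w Xx Xw)) (λ { refl → Xx })
    where
    isolated : ∀ {w} → Reach G X x w → w ≡ x
    isolated here           = refl
    isolated (step e Xw′ _) with D-neighbours-onCycle (X⊆D x Xx) (X⊆D _ Xw′) e
    ... | i , x∈Cᵢ , _ = ⊥-elim (x∉C (i , x∈Cᵢ))

mainTheorem17 : ∀ {n k} (G : Graph n) (bab : BAB G k) →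
    (∀ i → IsComponent G (D G full) (OnCycle (cyc bab i))) ×
    (∀ (X : Fin n → Set) → IsComponent G (D G full) X →
      (∀ i → ¬ (∀ v → X v ⇔ OnCycle (cyc bab i) v)) →
      Σ (Fin n) λ v → ∀ w → X w ⇔ (w ≡ v))
mainTheorem17 G bab = cycle-isComponent , other-components-singletons
  where open BABGraphs G bab
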